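{- Let $L$ be an invertible $G$-lattice. Then: (i) if $e\in L$ is short, then $\{\sigma\in G:\sigma e=e\}=\{1\}$; (ii) if $e\in L$ is short, then $\langle e,\sigma e\rangle=1$ if $\sigma=1$, $\langle e,\sigma e\rangle=-1$ if $\sigma=u$, and $\langle e,\sigma e\rangle=0$ for all other $\sigma\in G$; (iii) an element $e\in L$ is short if and only if $e\cdot\bar e=1$.
   Context: Let $G$ be a finite abelian group with a fixed element $u$ of order $2$, $n=\#G/2$. A lattice is a finitely generated abelian group with a bilinear, symmetric, positive definite $\mathbb{Z}$-valued form $\langle\cdot,\cdot\rangle$; unimodular means Gram determinant $1$. A $G$-lattice is a lattice with a homomorphism from $G$ to its form-preserving automorphisms in which $u$ acts as $-1$. A $G$-lattice $L$ is invertible if it has rank $n$, is unimodular, and for every $m\in\mathbb{Z}_{>0}$ there is $e_m\in L$ such that $\{\sigma e_m+mL:\sigma\in G\}$ generates $L/mL$ as an abelian group. A vector $e$ is short if $\langle e,e\rangle=1$. Let $\mathbb{Z}\langle G\rangle=\mathbb{Z}[G]/(u+1)$. For a $G$-lattice $L$, $\bar L$ is a copy of $L$ via $x\mapsto\bar x$ with $G$-action $\sigma\bar x=\overline{\sigma^{ -1}x}$, and for a set $S$ of coset representatives of $G/\langle u\rangle$ the lifted inner product is $x\cdot\bar y=\sum_{\sigma\in S}\langle x,\sigma y\rangle\sigma\in\mathbb{Z}\langle G\rangle$ (independent of $S$). -}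

module Defs where

open import Data.Nat as ℕ using (ℕ; zero; suc)
open import Data.Integer using (ℤ; +_; -_; _+_; _*_; _-_; _<_)
open import Data.Fin using (Fin; zero; suc; punchIn; toℕ)
open import Data.Fin.Properties using () renaming (_≟_ to _≟ᶠ_)
open import Data.Product using (Σ; ∃; _×_; _,_)
open import Data.Sum using (_⊎_)
open import Relation.Nullary using (¬_; yes; no)
open import Relation.Binary.PropositionalEquality using (_≡_; _≢_)
open import Algebra.Structures using (IsAbelianGroup)

∑ : ∀ {k} → (Fin k → ℤ) → ℤ
∑ {zero}  f = + 0
∑ {suc k} f = f zero + ∑ (λ i → f (suc i))

Vec : ℕ → Set
Vec n = Fin n → ℤ

Matrix : ℕ → Set
Matrix n = Fin n → Fin n → ℤ

alt : ℕ → ℤ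
alt zero    = + 1
alt (suc k) = - alt k

det : ∀ {n} → Matrix n → ℤ
det {zero}  M = + 1
det {suc n} M =
  ∑ (λ j → alt (toℕ j) * M zero j * det (λ i k → M (suc i) (punchIn j k)))

_⋆_ : ∀ {n} → Matrix n → Vec n → Vec n
(A ⋆ x) i = ∑ (λ j → A i j * x j)

record FinAbGroup2 (n : ℕ) : Set where
  field
    _∙_            : Fin (2 ℕ.* n) → Fin (2 ℕ.* n) → Fin (2 ℕ.* n)
    ε              : Fin (2 ℕ.* n)
    _⁻¹            : Fin (2 ℕ.* n) → Fin (2 ℕ.* n)
    isAbelianGroup : IsAbelianGroup _≡_ _∙_ ε _⁻¹
    u              : Fin (2 ℕ.* n)
    u≢ε            : u ≢ ε
    u∙u≡ε          : u ∙ u ≡ ε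

record GLattice {n : ℕ} (G : FinAbGroup2 n) : Set where
  open FinAbGroup2 G
  field
    gram        : Matrix n
    gram-sym    : ∀ i j → gram i j ≡ gram j i
  ⟨_,_⟩ : Vec n → Vec n → ℤ
  ⟨ x , y ⟩ = ∑ (λ i → ∑ (λ j → x i * gram i j * y j))
  field
    gram-posdef : ∀ (x : Vec n) → (Σ (Fin n) λ i → x i ≢ + 0) → + 0 < ⟨ x , x ⟩
    ρ           : Fin (2 ℕ.* n) → Matrix n
    act-ε       : ∀ x i → (ρ ε ⋆ x) i ≡ x i
    act-∙       : ∀ σ τ x i → (ρ (σ ∙ τ) ⋆ x) i ≡ (ρ σ ⋆ (ρ τ ⋆ x)) i
    act-form    : ∀ σ x y → ⟨ ρ σ ⋆ x , ρ σ ⋆ y ⟩ ≡ ⟨ x , y ⟩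
    act-u       : ∀ x i → (ρ u ⋆ x) i ≡ - x i

  short : Vec n → Set
  short e = ⟨ e , e ⟩ ≡ + 1

  -- invertible: rank n (built in), unimodular, and for every m > 0 some
  -- e_m whose G-orbit generates L/mL
  Invertible : Set
  Invertible =
    det gram ≡ + 1 ×
    (∀ (m : ℕ) → 0 ℕ.< m → ∃ λ (e : Vec n) →
       ∀ (x : Vec n) → ∃ λ (c : Fin (2 ℕ.* n) → ℤ) → ∃ λ (y : Vec n) →
         ∀ i → x i ≡ ∑ (λ σ → c σ * (ρ σ ⋆ e) i) + (+ m) * y i)

  ℤ[G] : Set
  ℤ[G] = Fin (2 ℕ.* n) → ℤ

  δ : Fin (2 ℕ.* n) → ℤ[G]
  δ g τ with τ ≟ᶠ g
  ... | yes _ = + 1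
  ... | no  _ = + 0

  _⊕_ : ℤ[G] → ℤ[G] → ℤ[G]
  (f ⊕ g) τ = f τ + g τ

  _⊛_ : ℤ[G] → ℤ[G] → ℤ[G]
  (f ⊛ g) τ = ∑ (λ σ → f σ * g ((σ ⁻¹) ∙ τ))

  -- equality in ℤ⟨G⟩: difference lies in the ideal (u+1)
  _≈⟨G⟩_ : ℤ[G] → ℤ[G] → Set
  f ≈⟨G⟩ g = ∃ λ (h : ℤ[G]) → ∀ τ → f τ - g τ ≡ ((δ u ⊕ δ ε) ⊛ h) τ

  IsCosetReps : (Fin n → Fin (2 ℕ.* n)) → Set
  IsCosetReps s =
    (∀ g → Σ (Fin n) λ i → g ≡ s i ⊎ g ≡ u ∙ s i) ×
    (∀ i j → (s i ≡ s j ⊎ s i ≡ u ∙ s j) → i ≡ j)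

  -- lifted inner product x · ȳ = Σ_{σ∈S} ⟨x, σ y⟩ σ
  lifted : (Fin n → Fin (2 ℕ.* n)) → Vec n → Vec n → ℤ[G]
  lifted s x y τ = ∑ (λ i → δ (s i) τ * ⟨ x , ρ (s i) ⋆ y ⟩)

{-# OPTIONS --safe #-}
module Submission where

-- The heart is (i). Suppose τ ∉ {1, u} fixes the short vector e and let R ≥ 2 be the order
-- of τ modulo ⟨u⟩, so that H = ⟨u, τ⟩ has order 2R. The G-orbit of e_R generates L/RL; as
-- rank L = #G/2, choosing representatives of G/⟨u⟩ gives n vectors spanning (ℤ/R)ⁿ, which
-- are therefore a basis (a surjective self-map of a finite set is injective). Hence if
-- e = Σ a_σ σe_R + R y, the invariance τe = e forces the coefficients D(σ) = a_σ − a_{uσ}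
-- to satisfy D(τσ) ≡ D(σ) mod R. The function f(σ) = ⟨e, σe_R⟩ is τ-invariant and changes
-- sign under u, so k = D f is u-invariant and τ-invariant mod R; its sum over every H-coset
-- is then divisible by 2R, and summing over the cosets gives 2R ∣ Σ k = 2(⟨e, e⟩ − R⟨e, y⟩),
-- i.e. R ∣ 1. Part (ii) follows from (i) because two short vectors have inner product
-- 0 or ±1, and ±1 only when they agree up to sign. Part (iii) reduces to (ii): an element
-- of ℤ[G] vanishes in ℤ⟨G⟩ iff its coefficients satisfy c_σ = c_{uσ}, and the coefficients
-- of e·ē antisymmetrised in this way are exactly the ⟨e, σe⟩.

open import Defs
open import Data.Nat using (ℕ)
open import Data.Fin using (Fin)
open import Relation.Binary.PropositionalEquality using (_≡_)
open import Algebra.Structures using (IsGroup)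

module FiniteSums where
  open import Data.Nat as ℕ using (zero; suc)
  open import Data.Integer using (ℤ; +_; -_; _+_; _-_; _*_; 0ℤ)
  import Data.Integer.Properties as ℤ
  open import Data.Integer.Tactic.RingSolver using (solve-∀)
  open import Data.Fin using (zero; suc; punchIn; _↑ˡ_; _↑ʳ_)
  open import Data.Fin.Properties using (punchInᵢ≢i)
  open import Data.Fin.Permutation using (Permutation′; _⟨$⟩ʳ_)
  import Algebra.Properties.CommutativeMonoid.Sum as MonoidSum
  open import Function using (_∘_)
  open import Relation.Binary.PropositionalEquality

  private
    module Σ = MonoidSum ℤ.+-0-commutativeMonoid

    ∑≡sum : ∀ {k} (f : Fin k → ℤ) → ∑ f ≡ Σ.sum f
    ∑≡sum {zero}  f = refl
    ∑≡sum {suc k} f = cong (_+_ (f zero)) (∑≡sum (f ∘ suc))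

  ∑-cong : ∀ {k} {f g : Fin k → ℤ} → f ≗ g → ∑ f ≡ ∑ g
  ∑-cong {zero}  f≗g = refl
  ∑-cong {suc k} f≗g = cong₂ _+_ (f≗g zero) (∑-cong (f≗g ∘ suc))

  ∑-zero : ∀ {k} {f : Fin k → ℤ} → (∀ i → f i ≡ 0ℤ) → ∑ f ≡ 0ℤ
  ∑-zero {zero}  f≡0 = refl
  ∑-zero {suc k} f≡0 = cong₂ _+_ (f≡0 zero) (∑-zero (f≡0 ∘ suc))

  ∑-distrib-+ : ∀ {k} (f g : Fin k → ℤ) → ∑ (λ i → f i + g i) ≡ ∑ f + ∑ g
  ∑-distrib-+ {zero}  f g = refl
  ∑-distrib-+ {suc k} f g =
    trans (cong (_+_ (f zero + g zero)) (∑-distrib-+ (f ∘ suc) (g ∘ suc)))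
          (interchange (f zero) (g zero) (∑ (f ∘ suc)) (∑ (g ∘ suc)))
    where
    interchange : ∀ a b c d → a + b + (c + d) ≡ a + c + (b + d)
    interchange = solve-∀

  ∑-neg : ∀ {k} (f : Fin k → ℤ) → ∑ (λ i → - f i) ≡ - ∑ f
  ∑-neg {zero}  f = refl
  ∑-neg {suc k} f = trans (cong (_+_ (- f zero)) (∑-neg (f ∘ suc)))
                          (sym (ℤ.neg-distrib-+ (f zero) (∑ (f ∘ suc))))

  ∑-distrib-minus : ∀ {k} (f g : Fin k → ℤ) → ∑ (λ i → f i - g i) ≡ ∑ f - ∑ g
  ∑-distrib-minus f g = trans (∑-distrib-+ f (λ i → - g i)) (cong (_+_ (∑ f)) (∑-neg g))

  *-distribˡ-∑ : ∀ {k} (c : ℤ) (f : Fin k → ℤ) → c * ∑ f ≡ ∑ (λ i → c * f i)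
  *-distribˡ-∑ {zero}  c f = ℤ.*-zeroʳ c
  *-distribˡ-∑ {suc k} c f = trans (ℤ.*-distribˡ-+ c (f zero) (∑ (f ∘ suc)))
                                   (cong (_+_ (c * f zero)) (*-distribˡ-∑ c (f ∘ suc)))

  *-distribʳ-∑ : ∀ {k} (c : ℤ) (f : Fin k → ℤ) → ∑ f * c ≡ ∑ (λ i → f i * c)
  *-distribʳ-∑ c f = trans (ℤ.*-comm (∑ f) c)
                           (trans (*-distribˡ-∑ c f) (∑-cong (λ i → ℤ.*-comm c (f i))))

  ∑-const : ∀ {k} (c : ℤ) → ∑ {k} (λ _ → c) ≡ + k * c
  ∑-const {zero}  c = sym (ℤ.*-zeroˡ c)
  ∑-const {suc k} c = trans (cong (_+_ c) (∑-const {k} c)) (collect c (+ k))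
    where
    collect : ∀ c k → c + k * c ≡ (+ 1 + k) * c
    collect = solve-∀

  ∑-comm : ∀ {k l} (f : Fin k → Fin l → ℤ) →
           ∑ (λ i → ∑ (λ j → f i j)) ≡ ∑ (λ j → ∑ (λ i → f i j))
  ∑-comm {zero}  {l} f = sym (∑-zero {l} (λ _ → refl))
  ∑-comm {suc k}     f = trans (cong (_+_ (∑ (f zero))) (∑-comm (f ∘ suc)))
                               (sym (∑-distrib-+ (f zero) (λ j → ∑ (λ i → f (suc i) j))))

  ∑-++ : ∀ {k l} (f : Fin (k ℕ.+ l) → ℤ) →
         ∑ f ≡ ∑ (λ i → f (i ↑ˡ l)) + ∑ (λ j → f (k ↑ʳ j))
  ∑-++ {zero}      f = sym (ℤ.+-identityˡ (∑ f))
  ∑-++ {suc k} {l} f = trans (cong (_+_ (f zero)) (∑-++ {k} {l} (f ∘ suc)))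
                             (sym (ℤ.+-assoc (f zero) (∑ (λ i → f (suc (i ↑ˡ l)))) _))

  ∑-permute : ∀ {k} (π : Permutation′ k) (f : Fin k → ℤ) → ∑ f ≡ ∑ (λ i → f (π ⟨$⟩ʳ i))
  ∑-permute π f = trans (∑≡sum f) (trans (Σ.sum-permute f π) (sym (∑≡sum (λ i → f (π ⟨$⟩ʳ i)))))

  ∑-remove : ∀ {k} (i : Fin (suc k)) (f : Fin (suc k) → ℤ) → ∑ f ≡ f i + ∑ (f ∘ punchIn i)
  ∑-remove i f = trans (∑≡sum f)
    (trans (Σ.sum-remove {i = i} f) (cong (_+_ (f i)) (sym (∑≡sum (f ∘ punchIn i)))))

  ∑-single : ∀ {k} (i : Fin k) {f : Fin k → ℤ} → (∀ j → j ≢ i → f j ≡ 0ℤ) → ∑ f ≡ f i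
  ∑-single {suc k} i {f} f≡0 =
    trans (∑-remove i f)
          (trans (cong (_+_ (f i)) (∑-zero (λ j → f≡0 (punchIn i j) (punchInᵢ≢i i j))))
                 (ℤ.+-identityʳ (f i)))

module Divisibility where
  open import Data.Nat using (zero; suc)
  open import Data.Integer using (ℤ; -_; _-_; 0ℤ)
  import Data.Integer.Properties as ℤ
  open import Data.Integer.Divisibility.Signed
  open import Data.Integer.Tactic.RingSolver using (solve-∀)
  open import Data.Fin using (zero; suc)
  open import Function using (_∘_)
  open import Relation.Binary.PropositionalEquality

  ∣-zero : ∀ k → k ∣ 0ℤ
  ∣-zero k = divides 0ℤ (sym (ℤ.*-zeroˡ k))

  ∣-∑ : ∀ {m k} {f : Fin k → ℤ} → (∀ i → m ∣ f i) → m ∣ ∑ f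
  ∣-∑ {m} {zero}  m∣f = ∣-zero m
  ∣-∑ {m} {suc k} m∣f = ∣m∣n⇒∣m+n (m∣f zero) (∣-∑ (m∣f ∘ suc))

  ∣-flip : ∀ {m} x y → m ∣ x - y → m ∣ y - x
  ∣-flip x y m∣x-y = subst (_ ∣_) (negate x y) (∣m⇒∣-m m∣x-y)
    where
    negate : ∀ x y → - (x - y) ≡ y - x
    negate = solve-∀

module Residues where
  open import Data.Nat as ℕ using (ℕ; zero; suc; _∸_; NonZero)
  import Data.Nat.Properties as ℕ
  open import Data.Nat.Divisibility as ℕ using (>⇒∤)
  open import Data.Integer as ℤ using (ℤ; +_; _+_; _-_; _*_)
  import Data.Integer.Properties as ℤ
  open import Data.Integer.Divisibility.Signed
  open import Data.Integer.DivMod using (_%ℕ_; _/ℕ_; n%ℕd<d; a≡a%ℕn+[a/ℕn]*n)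
  open import Data.Integer.Tactic.RingSolver using (solve-∀)
  open import Data.Fin using (toℕ; fromℕ<)
  open import Data.Fin.Properties using (toℕ-fromℕ<; toℕ-injective; toℕ<n)
  open import Data.Sum using (inj₁; inj₂)
  open import Relation.Nullary using (contradiction)
  open import Relation.Binary.PropositionalEquality
  open Divisibility

  toℤ : ∀ {d} → Fin d → ℤ
  toℤ r = + toℕ r

  private
    ∣∧<⇒≡0 : ∀ {c d} → c ℕ.< d → d ℕ.∣ c → c ≡ 0
    ∣∧<⇒≡0 {zero}  c<d d∣c = refl
    ∣∧<⇒≡0 {suc c} c<d d∣c = contradiction d∣c (>⇒∤ c<d)

    ∣-between-ordered : ∀ {d a b} → b ℕ.< d → a ℕ.≤ b → + d ∣ + a - + b → a ≡ b
    ∣-between-ordered {d} {a} {b} b<d a≤b d∣a-b = ℕ.≤-antisym a≤b (ℕ.m∸n≡0⇒m≤n b∸a≡0)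
      where
      d∣b∸a : d ℕ.∣ b ∸ a
      d∣b∸a = subst (d ℕ.∣_) (trans (cong ℤ.∣_∣ (ℤ.m-n≡m⊖n a b)) (ℤ.∣⊖∣-≤ a≤b))
                    (∣⇒∣ᵤ d∣a-b)
      b∸a≡0 : b ∸ a ≡ 0
      b∸a≡0 = ∣∧<⇒≡0 (ℕ.≤-<-trans (ℕ.m∸n≤m b a) b<d) d∣b∸a

  ∣-between-small⇒≡ : ∀ {d a b} → a ℕ.< d → b ℕ.< d → + d ∣ + a - + b → a ≡ b
  ∣-between-small⇒≡ {a = a} {b} a<d b<d d∣a-b with ℕ.≤-total a b
  ... | inj₁ a≤b = ∣-between-ordered b<d a≤b d∣a-b
  ... | inj₂ b≤a = sym (∣-between-ordered a<d b≤a (∣-flip (+ a) (+ b) d∣a-b))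

  module _ (d : ℕ) .{{_ : NonZero d}} where

    residue : ℤ → Fin d
    residue x = fromℕ< (n%ℕd<d x d)

    ∣-residue : ∀ x → + d ∣ x - toℤ (residue x)
    ∣-residue x = divides (x /ℕ d) (begin
      x - toℤ (residue x)                     ≡⟨ cong (λ r → x - + r) (toℕ-fromℕ< (n%ℕd<d x d)) ⟩
      x - + (x %ℕ d)                          ≡⟨ cong (_- + (x %ℕ d)) (a≡a%ℕn+[a/ℕn]*n x d) ⟩
      + (x %ℕ d) + x /ℕ d * + d - + (x %ℕ d)  ≡⟨ cancel (+ (x %ℕ d)) (x /ℕ d * + d) ⟩
      x /ℕ d * + d                            ∎)
      where
      open ≡-Reasoning
      cancel : ∀ r q → r + q - r ≡ q
      cancel = solve-∀

    residue-unique : ∀ x r → + d ∣ x - toℤ r → residue x ≡ r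
    residue-unique x r d∣x-r = toℕ-injective (∣-between-small⇒≡ (toℕ<n (residue x)) (toℕ<n r)
      (subst (_ ∣_) (difference x (toℤ (residue x)) (toℤ r)) (∣m∣n⇒∣m-n d∣x-r (∣-residue x))))
      where
      difference : ∀ x a b → x - b - (x - a) ≡ a - b
      difference = solve-∀

    residue-cong : ∀ x y → + d ∣ x - y → residue x ≡ residue y
    residue-cong x y d∣x-y = residue-unique x (residue y)
      (subst (_ ∣_) (telescope x y (toℤ (residue y))) (∣m∣n⇒∣m+n d∣x-y (∣-residue y)))
      where
      telescope : ∀ x y z → x - y + (y - z) ≡ x - z
      telescope = solve-∀

    residue-toℤ : ∀ r → residue (toℤ r) ≡ r
    residue-toℤ r = residue-unique (toℤ r) r (subst (_ ∣_) (sym (ℤ.+-inverseʳ (toℤ r))) (∣-zero _))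

    residue-≡⇒∣ : ∀ x y → residue x ≡ residue y → + d ∣ x - y
    residue-≡⇒∣ x y eq = subst (_ ∣_) (cancel x y (toℤ (residue y)))
      (subst (λ r → + d ∣ x - toℤ r - (y - toℤ (residue y))) eq
             (∣m∣n⇒∣m-n (∣-residue x) (∣-residue y)))
      where
      cancel : ∀ x y a → x - a - (y - a) ≡ x - y
      cancel = solve-∀

module FiniteMaps where
  open import Data.Nat as ℕ using (zero; suc; _^_)
  import Data.Nat.Properties as ℕ
  open import Data.Fin using (zero; suc; punchOut; combine; funToFin; finToFun)
  open import Data.Fin.Properties as Fin
    using (any?; injective⇒≤; punchOut-injective; funToFin-finToFin; finToFun-funToFin)
  open import Data.Product using (∃; _,_; proj₁; proj₂)
  open import Function using (_∘_)
  open import Function.Definitions using (Injective)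
  open import Relation.Nullary using (yes; no; contradiction)
  open import Relation.Binary.PropositionalEquality

  injective⇒surjective : ∀ {N} {f : Fin N → Fin N} → Injective _≡_ _≡_ f → ∀ y → ∃ λ x → f x ≡ y
  injective⇒surjective {suc N} {f} f-injective y with any? (λ x → f x Fin.≟ y)
  ... | yes hit = hit
  ... | no  miss = contradiction (injective⇒≤ avoid-y-injective) (ℕ.<-irrefl refl)
    where
    avoid-y : Fin (suc N) → Fin N
    avoid-y x = punchOut {i = y} (λ y≡fx → miss (x , sym y≡fx))
    avoid-y-injective : Injective _≡_ _≡_ avoid-y
    avoid-y-injective {x} {x′} = f-injective ∘
      punchOut-injective (λ y≡fx → miss (x , sym y≡fx)) (λ y≡fx′ → miss (x′ , sym y≡fx′))

  surjective⇒injective : ∀ {N} {f : Fin N → Fin N} → (∀ y → ∃ λ x → f x ≡ y) → Injective _≡_ _≡_ f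
  surjective⇒injective {f = f} f-surjective {x} {x′} fx≡fx′ =
    trans (sym (g∘f x)) (trans (cong g fx≡fx′) (g∘f x′))
    where
    g : _ → _
    g = proj₁ ∘ f-surjective
    f∘g : ∀ y → f (g y) ≡ y
    f∘g = proj₂ ∘ f-surjective
    g-injective : Injective _≡_ _≡_ g
    g-injective {y} {y′} gy≡gy′ = trans (sym (f∘g y)) (trans (cong f gy≡gy′) (f∘g y′))
    g∘f : ∀ x → g (f x) ≡ x
    g∘f x with injective⇒surjective g-injective x
    ... | y , refl = cong g (f∘g y)

  funToFin-cong : ∀ {m n} {f g : Fin m → Fin n} → f ≗ g → funToFin f ≡ funToFin g
  funToFin-cong {zero}  f≗g = refl
  funToFin-cong {suc m} f≗g = cong₂ combine (f≗g zero) (funToFin-cong (f≗g ∘ suc))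

  pointwise-surjective⇒injective : ∀ {n d} (Φ : (Fin n → Fin d) → (Fin n → Fin d)) →
    (∀ {a b} → a ≗ b → Φ a ≗ Φ b) → (∀ w → ∃ λ a → Φ a ≗ w) →
    ∀ {a b} → Φ a ≗ Φ b → a ≗ b
  pointwise-surjective⇒injective {n} {d} Φ Φ-cong Φ-surjective {a} {b} Φa≗Φb i = begin
    a i                          ≡⟨ finToFun-funToFin a i ⟨
    finToFun (funToFin a) i      ≡⟨ cong (λ k → finToFun k i) (Φ̂-injective Φ̂a≡Φ̂b) ⟩
    finToFun (funToFin b) i      ≡⟨ finToFun-funToFin b i ⟩
    b i                          ∎
    where
    open ≡-Reasoning
    Φ̂ : Fin (d ^ n) → Fin (d ^ n)
    Φ̂ k = funToFin (Φ (finToFun k))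
    Φ̂-funToFin : ∀ a → Φ̂ (funToFin a) ≡ funToFin (Φ a)
    Φ̂-funToFin a = funToFin-cong (Φ-cong (finToFun-funToFin a))
    Φ̂-surjective : ∀ k → ∃ λ k′ → Φ̂ k′ ≡ k
    Φ̂-surjective k with Φ-surjective (finToFun k)
    ... | a , Φa≗k = funToFin a ,
      trans (Φ̂-funToFin a) (trans (funToFin-cong Φa≗k) (funToFin-finToFin {n} {d} k))
    Φ̂-injective : Injective _≡_ _≡_ Φ̂
    Φ̂-injective = surjective⇒injective Φ̂-surjective
    Φ̂a≡Φ̂b : Φ̂ (funToFin a) ≡ Φ̂ (funToFin b)
    Φ̂a≡Φ̂b = trans (Φ̂-funToFin a) (trans (funToFin-cong Φa≗Φb) (sym (Φ̂-funToFin b)))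

module Minima where
  open import Data.Nat as ℕ using (zero; suc)
  import Data.Nat.Properties as ℕ
  open import Data.Nat.Induction using (<-rec)
  open import Data.Fin using (zero; suc; toℕ; fromℕ<; _≤_; _≤?_)
  open import Data.Fin.Properties as Fin using (any?; toℕ<n; toℕ-fromℕ<)
  open import Data.Product using (∃; _×_; _,_)
  open import Function using (_∘_)
  open import Relation.Nullary using (yes; no; ¬_)
  open import Relation.Unary using (Decidable)
  open import Relation.Binary.PropositionalEquality

  argmin : ∀ {K M} (f : Fin (suc K) → Fin M) → ∃ λ i → ∀ j → f i ≤ f j
  argmin {zero}  f = zero , λ { zero → Fin.≤-refl }
  argmin {suc K} f with argmin (f ∘ suc)
  ... | i , fi≤ with f zero ≤? f (suc i)
  ...   | yes f0≤fi = zero , λ { zero → Fin.≤-refl ; (suc j) → Fin.≤-trans f0≤fi (fi≤ j) }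
  ...   | no  f0≰fi = suc i , λ { zero → ℕ.<⇒≤ (ℕ.≰⇒> f0≰fi) ; (suc j) → fi≤ j }

  least-witness : ∀ {P : ℕ → Set} → Decidable P → ∀ {N} → P N →
                  ∃ λ r → P r × (∀ {k} → k ℕ.< r → ¬ P k)
  least-witness {P} P? {N} = <-rec _ search N
    where
    search : ∀ N → (∀ {M} → M ℕ.< N → P M → ∃ λ r → P r × (∀ {k} → k ℕ.< r → ¬ P k)) →
             P N → ∃ λ r → P r × (∀ {k} → k ℕ.< r → ¬ P k)
    search N below pN with any? (λ (k : Fin N) → P? (toℕ k))
    ... | yes (k , pk) = below (toℕ<n k) pk
    ... | no  none     = N , pN , λ k<N pk → none (fromℕ< k<N , subst P (sym (toℕ-fromℕ< k<N)) pk)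

module LinearCombinations where
  open import Data.Nat using (NonZero)
  open import Data.Integer using (ℤ; +_; -_; _+_; _-_; _*_; 0ℤ)
  import Data.Integer.Properties as ℤ
  open import Data.Integer.Divisibility.Signed
  open import Data.Integer.Tactic.RingSolver using (solve-∀)
  open import Data.Product using (∃; ∃₂; _,_)
  open import Function using (_∘_)
  open import Relation.Binary.PropositionalEquality
  open FiniteSums
  open Divisibility
  open Residues
  open FiniteMaps using (pointwise-surjective⇒injective)

  infixl 6 _+ᵥ_ _-ᵥ_
  infixl 7 _·ᵥ_
  infix  8 -ᵥ_

  _+ᵥ_ _-ᵥ_ : ∀ {n} → Vec n → Vec n → Vec n
  (x +ᵥ y) j = x j + y j
  (x -ᵥ y) j = x j - y j

  -ᵥ_ : ∀ {n} → Vec n → Vec n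
  (-ᵥ x) j = - x j

  _·ᵥ_ : ∀ {n} → ℤ → Vec n → Vec n
  (m ·ᵥ x) j = m * x j

  lincomb : ∀ {k n} → (Fin k → ℤ) → (Fin k → Vec n) → Vec n
  lincomb c v j = ∑ (λ i → c i * v i j)

  dot : ∀ {n} → Vec n → Vec n → ℤ
  dot w x = ∑ (λ j → w j * x j)

  dot-+ : ∀ {n} (w x y : Vec n) → dot w (x +ᵥ y) ≡ dot w x + dot w y
  dot-+ w x y = trans (∑-cong (λ j → ℤ.*-distribˡ-+ (w j) (x j) (y j)))
                      (∑-distrib-+ (λ j → w j * x j) (λ j → w j * y j))

  dot-neg : ∀ {n} (w x : Vec n) → dot w (-ᵥ x) ≡ - dot w x
  dot-neg w x = trans (∑-cong (λ j → sym (ℤ.neg-distribʳ-* (w j) (x j)))) (∑-neg (λ j → w j * x j))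

  dot-minus : ∀ {n} (w x y : Vec n) → dot w (x -ᵥ y) ≡ dot w x - dot w y
  dot-minus w x y = trans (dot-+ w x (-ᵥ y)) (cong (_+_ (dot w x)) (dot-neg w y))

  dot-scale : ∀ {n} (w : Vec n) (m : ℤ) (x : Vec n) → dot w (m ·ᵥ x) ≡ m * dot w x
  dot-scale w m x = trans (∑-cong (λ j → swap (w j) m (x j))) (sym (*-distribˡ-∑ m (λ j → w j * x j)))
    where
    swap : ∀ a b c → a * (b * c) ≡ b * (a * c)
    swap = solve-∀

  dot-lincomb : ∀ {k n} (w : Vec n) (c : Fin k → ℤ) (v : Fin k → Vec n) →
                dot w (lincomb c v) ≡ ∑ (λ t → c t * dot w (v t))
  dot-lincomb w c v = begin
    ∑ (λ j → w j * ∑ (λ t → c t * v t j))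
      ≡⟨ ∑-cong (λ j → *-distribˡ-∑ (w j) (λ t → c t * v t j)) ⟩
    ∑ (λ j → ∑ (λ t → w j * (c t * v t j)))
      ≡⟨ ∑-comm (λ j t → w j * (c t * v t j)) ⟩
    ∑ (λ t → ∑ (λ j → w j * (c t * v t j)))
      ≡⟨ ∑-cong (λ t → dot-scale w (c t) (v t)) ⟩
    ∑ (λ t → c t * dot w (v t))
      ∎
    where open ≡-Reasoning

  lincomb-distrib-minus : ∀ {k n} (c c′ : Fin k → ℤ) (v : Fin k → Vec n) →
                      lincomb (λ i → c i - c′ i) v ≗ lincomb c v -ᵥ lincomb c′ v
  lincomb-distrib-minus c c′ v j = trans (∑-cong (λ i → factor (c i) (c′ i) (v i j)))
                                     (∑-distrib-minus (λ i → c i * v i j) (λ i → c′ i * v i j))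
    where
    factor : ∀ a b x → (a - b) * x ≡ a * x - b * x
    factor = solve-∀

  lincomb-cong-mod : ∀ {k n} (m : ℤ) (c c′ : Fin k → ℤ) (v : Fin k → Vec n) →
                     (∀ i → m ∣ c i - c′ i) → ∀ j → m ∣ lincomb c v j - lincomb c′ v j
  lincomb-cong-mod m c c′ v m∣c-c′ j =
    subst (m ∣_) (lincomb-distrib-minus c c′ v j) (∣-∑ (λ i → ∣m⇒∣m*n (v i j) (m∣c-c′ i)))

  -- n vectors spanning (ℤ/d)ⁿ induce a surjective, hence injective, self-map of (ℤ/d)ⁿ.
  spanning⇒independent-mod : ∀ {n} (d : ℕ) .{{_ : NonZero d}} (v : Fin n → Vec n) →
    (∀ x → ∃₂ λ (c : Fin n → ℤ) (y : Vec n) → x ≗ lincomb c v +ᵥ + d ·ᵥ y) →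
    ∀ c → (∀ j → + d ∣ lincomb c v j) → ∀ i → + d ∣ c i
  spanning⇒independent-mod {n} d v spanning c d∣cv i =
    subst (+ d ∣_) (ℤ.+-identityʳ (c i))
          (residue-≡⇒∣ d (c i) 0ℤ (Φ-injective {residue d ∘ c} {λ _ → residue d 0ℤ} Φc≗Φ0 i))
    where
    Φ : (Fin n → Fin d) → Fin n → Fin d
    Φ a j = residue d (lincomb (toℤ ∘ a) v j)

    Φ-cong : ∀ {a b} → a ≗ b → Φ a ≗ Φ b
    Φ-cong a≗b j = cong (residue d) (∑-cong (λ i → cong (λ r → toℤ r * v i j) (a≗b i)))

    Φ-residue : ∀ c → Φ (residue d ∘ c) ≗ residue d ∘ lincomb c v
    Φ-residue c j = residue-cong d (lincomb (toℤ ∘ residue d ∘ c) v j) (lincomb c v j)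
      (lincomb-cong-mod (+ d) (toℤ ∘ residue d ∘ c) c v (λ i → ∣-flip (c i) _ (∣-residue d (c i))) j)

    Φ-surjective : ∀ w → ∃ λ a → Φ a ≗ w
    Φ-surjective w with spanning (toℤ ∘ w)
    ... | c , y , w≗cv+dy = residue d ∘ c , λ j → trans (Φ-residue c j)
      (trans (residue-cong d (lincomb c v j) (toℤ (w j)) (∣-flip (toℤ (w j)) (lincomb c v j) (d∣w-cv j)))
             (residue-toℤ d (w j)))
      where
      cancel : ∀ l d y → l + d * y - l ≡ y * d
      cancel = solve-∀
      d∣w-cv : ∀ j → + d ∣ toℤ (w j) - lincomb c v j
      d∣w-cv j = subst (λ x → + d ∣ x - lincomb c v j) (sym (w≗cv+dy j))
                       (divides (y j) (cancel (lincomb c v j) (+ d) (y j)))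

    Φ-injective : ∀ {a b} → Φ a ≗ Φ b → a ≗ b
    Φ-injective = pointwise-surjective⇒injective Φ Φ-cong Φ-surjective

    Φc≗Φ0 : Φ (residue d ∘ c) ≗ Φ (λ _ → residue d 0ℤ)
    Φc≗Φ0 j = trans (Φ-residue c j)
      (trans (residue-cong d (lincomb c v j) 0ℤ (subst (+ d ∣_) (sym (ℤ.+-identityʳ _)) (d∣cv j)))
             (sym (trans (Φ-residue (λ _ → 0ℤ) j) (cong (residue d) (∑-zero (λ i → ℤ.*-zeroˡ (v i j)))))))

module Involutions where
  open import Data.Nat as ℕ using (zero; suc)
  import Data.Nat.Properties as ℕ
  open import Data.Integer using (ℤ; _+_)
  import Data.Integer.Properties as ℤ
  open import Data.Fin using (zero; suc; punchIn; punchOut)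
  open import Data.Fin.Properties using (punchInᵢ≢i; punchIn-injective; punchIn-punchOut; suc-injective; _≟_)
  open import Data.Product using (∃; _,_; proj₁; proj₂)
  open import Function using (_∘_)
  open import Relation.Nullary using (yes; no; contradiction)
  open import Relation.Binary.PropositionalEquality
  open FiniteSums

  record Pairing {k} (ι : Fin k → Fin k) : Set where
    field
      half      : ℕ
      rep       : Fin half → Fin k
      half+half : half ℕ.+ half ≡ k
      ∑-pairs   : ∀ (F : Fin k → ℤ) → ∑ F ≡ ∑ (λ i → F (rep i) + F (ι (rep i)))

  pairing : ∀ {k} (ι : Fin k → Fin k) → (∀ x → ι (ι x) ≡ x) → (∀ x → ι x ≢ x) → Pairing ι
  pairing {zero} ι _ _ = record { half = 0 ; rep = λ () ; half+half = refl ; ∑-pairs = λ _ → refl }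
  pairing {suc zero} ι _ ι-free with ι zero in ι0≡0
  ... | zero = contradiction ι0≡0 (ι-free zero)
  pairing {suc (suc k)} ι ι-involutive ι-free with ι zero in ι0≡1+p
  ... | zero  = contradiction ι0≡1+p (ι-free zero)
  ... | suc p = record
    { half      = suc (Pairing.half rest)
    ; rep       = rep
    ; half+half = cong suc (trans (ℕ.+-suc _ _) (cong suc (Pairing.half+half rest)))
    ; ∑-pairs   = ∑-pairs
    }
    where
    embed : Fin k → Fin (suc (suc k))
    embed y = suc (punchIn p y)

    embed-injective : ∀ {y y′} → embed y ≡ embed y′ → y ≡ y′
    embed-injective eq = punchIn-injective p _ _ (suc-injective eq)

    restrict : ∀ y → ∃ λ y′ → ι (embed y) ≡ embed y′
    restrict y with ι (embed y) in ιy≡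
    ... | zero = contradiction (suc-injective (trans (sym (ι-involutive (embed y))) (trans (cong ι ιy≡) ι0≡1+p)))
                               (punchInᵢ≢i p y)
    ... | suc z with p ≟ z
    ...   | yes refl = contradiction (trans (sym (ι-involutive zero)) (trans (cong ι (trans ι0≡1+p (sym ιy≡)))
                                                                             (ι-involutive (embed y))))
                                     (λ ())
    ...   | no  p≢z  = punchOut p≢z , cong suc (sym (punchIn-punchOut p≢z))

    ι′ : Fin k → Fin k
    ι′ = proj₁ ∘ restrict

    embed-ι′ : ∀ y → embed (ι′ y) ≡ ι (embed y)
    embed-ι′ = sym ∘ proj₂ ∘ restrict

    rest : Pairing ι′
    rest = pairing ι′
      (λ y → embed-injective
        (trans (embed-ι′ (ι′ y)) (trans (cong ι (embed-ι′ y)) (ι-involutive (embed y)))))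
      (λ y ι′y≡y → ι-free (embed y) (trans (sym (embed-ι′ y)) (cong embed ι′y≡y)))
    open Pairing rest using () renaming (rep to rep′; ∑-pairs to ∑-pairs′)

    rep : Fin (suc (Pairing.half rest)) → Fin (suc (suc k))
    rep zero    = zero
    rep (suc i) = embed (rep′ i)

    ∑-pairs : ∀ F → ∑ F ≡ ∑ (λ i → F (rep i) + F (ι (rep i)))
    ∑-pairs F = begin
      F zero + ∑ (F ∘ suc)
        ≡⟨ cong (_+_ (F zero)) (∑-remove p (F ∘ suc)) ⟩
      F zero + (F (suc p) + ∑ (F ∘ embed))
        ≡⟨ cong (λ s → F zero + (F (suc p) + s)) (∑-pairs′ (F ∘ embed)) ⟩
      F zero + (F (suc p) + ∑ (λ i → F (embed (rep′ i)) + F (embed (ι′ (rep′ i)))))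
        ≡⟨ sym (ℤ.+-assoc (F zero) (F (suc p)) _) ⟩
      F zero + F (suc p) + ∑ (λ i → F (embed (rep′ i)) + F (embed (ι′ (rep′ i))))
        ≡⟨ cong₂ (λ a s → F zero + F a + s) (sym ι0≡1+p)
                 (∑-cong (λ i → cong (λ x → F (embed (rep′ i)) + F x) (embed-ι′ (rep′ i)))) ⟩
      F zero + F (ι zero) + ∑ (λ i → F (embed (rep′ i)) + F (ι (embed (rep′ i))))
        ∎
      where open ≡-Reasoning

module FinGroups {N : ℕ} {_∙_ : Fin N → Fin N → Fin N} {ε : Fin N} {_⁻¹ : Fin N → Fin N}
                 (isGroup : IsGroup _≡_ _∙_ ε _⁻¹) where
  open import Data.Nat as ℕ using (zero; suc)
  import Data.Nat.Properties as ℕ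
  open import Data.Integer using (ℤ; _*_; 0ℤ; 1ℤ)
  import Data.Integer.Properties as ℤ
  open import Data.Integer.Divisibility.Signed using (_∣_; ∣n⇒∣m*n)
  open import Data.Fin using (toℕ; _≤_; _≤?_)
  open import Data.Fin.Properties using (all?; ≤-antisym; pigeonhole)
  open import Data.Fin.Permutation using (permutation)
  open import Data.Bool using (if_then_else_)
  open import Data.Product using (∃; _,_; proj₁; proj₂)
  open import Algebra.Bundles using (Group)
  import Algebra.Properties.Group as GroupProperties
  open import Function.Definitions using (Injective)
  open import Relation.Nullary using (¬_; does)
  open import Relation.Nullary.Decidable using (dec-true; dec-false)
  open import Relation.Binary.PropositionalEquality
  open FiniteSums
  open Divisibility using (∣-∑)
  open FiniteMaps using (injective⇒surjective)
  open Minima using (argmin)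

  group : Group _ _
  group = record { Carrier = Fin N ; _≈_ = _≡_ ; _∙_ = _∙_ ; ε = ε ; _⁻¹ = _⁻¹ ; isGroup = isGroup }

  open Group group using (assoc; identityˡ)
  open GroupProperties group using (∙-cancelʳ; \\-leftDividesˡ; \\-leftDividesʳ)

  _^_ : Fin N → ℕ → Fin N
  g ^ zero  = ε
  g ^ suc j = g ∙ (g ^ j)

  ^-+ : ∀ g i j → g ^ (i ℕ.+ j) ≡ (g ^ i) ∙ (g ^ j)
  ^-+ g zero    j = sym (identityˡ (g ^ j))
  ^-+ g (suc i) j = trans (cong (g ∙_) (^-+ g i j)) (sym (assoc g (g ^ i) (g ^ j)))

  ∃-period : ∀ g → ∃ λ r → g ^ suc r ≡ ε
  ∃-period g with pigeonhole (ℕ.n<1+n N) (λ (i : Fin (suc N)) → g ^ toℕ i)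
  ... | i , j , i<j , gⁱ≡gʲ = d , ∙-cancelʳ (g ^ toℕ i) (g ^ suc d) ε (begin
    (g ^ suc d) ∙ (g ^ toℕ i)  ≡⟨ sym (^-+ g (suc d) (toℕ i)) ⟩
    g ^ (suc d ℕ.+ toℕ i)      ≡⟨ cong (g ^_) (trans (sym (ℕ.+-suc d (toℕ i))) (ℕ.m∸n+n≡m i<j)) ⟩
    g ^ toℕ j                  ≡⟨ sym gⁱ≡gʲ ⟩
    g ^ toℕ i                  ≡⟨ sym (identityˡ (g ^ toℕ i)) ⟩
    ε ∙ (g ^ toℕ i)            ∎)
    where
    open ≡-Reasoning
    d : ℕ
    d = toℕ j ℕ.∸ suc (toℕ i)

  ∑-translate : ∀ a (F : Fin N → ℤ) → ∑ F ≡ ∑ (λ σ → F (a ∙ σ))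
  ∑-translate a = ∑-permute (permutation (a ∙_) ((a ⁻¹) ∙_) (\\-leftDividesˡ a) (\\-leftDividesʳ a))

  -- Sums over G are taken coset by coset, each coset Hσ of the subgroup enumerated by h being
  -- represented by its least element in the order of Fin N.
  module Cosets {K : ℕ} (h : Fin (suc K) → Fin N) (h-injective : Injective _≡_ _≡_ h)
                (h-closed : ∀ i j → ∃ λ l → h i ∙ h j ≡ h l) where

    h-divides : ∀ i j → ∃ λ l → (h l) ∙ (h i) ≡ h j
    h-divides i j with injective⇒surjective right-multiple-injective j
      where
      right-multiple-injective : Injective _≡_ _≡_ (λ l → proj₁ (h-closed l i))
      right-multiple-injective {l} {l′} eq = h-injective (∙-cancelʳ (h i) (h l) (h l′)
        (trans (proj₂ (h-closed l i)) (trans (cong h eq) (sym (proj₂ (h-closed l′ i))))))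
    ... | l , refl = l , proj₂ (h-closed l i)

    IsLeast : Fin N → Set
    IsLeast σ = ∀ i → σ ≤ h i ∙ σ

    leader : Fin N → ℤ
    leader σ = if does (all? (λ i → σ ≤? h i ∙ σ)) then 1ℤ else 0ℤ

    leader-least : ∀ {σ} → IsLeast σ → leader σ ≡ 1ℤ
    leader-least {σ} least = cong (if_then 1ℤ else 0ℤ) (dec-true (all? (λ i → σ ≤? h i ∙ σ)) least)

    leader-¬least : ∀ {σ} → ¬ IsLeast σ → leader σ ≡ 0ℤ
    leader-¬least {σ} ¬least = cong (if_then 1ℤ else 0ℤ) (dec-false (all? (λ i → σ ≤? h i ∙ σ)) ¬least)

    least-≤-coset : ∀ {σ i} → IsLeast (h i ∙ σ) → ∀ j → h i ∙ σ ≤ h j ∙ σ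
    least-≤-coset {σ} {i} least j with h-divides i j
    ... | l , hl∙hi≡hj =
      subst (h i ∙ σ ≤_) (trans (sym (assoc (h l) (h i) σ)) (cong (_∙ σ) hl∙hi≡hj)) (least l)

    least-exists : ∀ σ → ∃ λ i → IsLeast (h i ∙ σ)
    least-exists σ with argmin (λ i → h i ∙ σ)
    ... | i , minimal = i , λ j → subst (h i ∙ σ ≤_) (step j) (minimal (proj₁ (h-closed j i)))
      where
      step : ∀ j → h (proj₁ (h-closed j i)) ∙ σ ≡ h j ∙ (h i ∙ σ)
      step j = trans (cong (_∙ σ) (sym (proj₂ (h-closed j i)))) (assoc (h j) (h i) σ)

    least-unique : ∀ σ {i j} → IsLeast (h i ∙ σ) → IsLeast (h j ∙ σ) → i ≡ j
    least-unique σ {i} {j} least-i least-j = h-injective (∙-cancelʳ σ (h i) (h j)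
      (≤-antisym (least-≤-coset least-i j) (least-≤-coset least-j i)))

    ∑-leader-coset : ∀ σ → ∑ (λ i → leader (h i ∙ σ)) ≡ 1ℤ
    ∑-leader-coset σ with least-exists σ
    ... | i , least =
      trans (∑-single i (λ j j≢i → leader-¬least (λ least-j → j≢i (least-unique σ least-j least))))
            (leader-least least)

    ∑-by-cosets : ∀ (k : Fin N → ℤ) → ∑ k ≡ ∑ (λ σ → leader σ * ∑ (λ i → k ((h i ⁻¹) ∙ σ)))
    ∑-by-cosets k = begin
      ∑ k
        ≡⟨ ∑-cong (λ σ → sym (trans (cong (k σ *_) (∑-leader-coset σ)) (ℤ.*-identityʳ (k σ)))) ⟩
      ∑ (λ σ → k σ * ∑ (λ i → leader (h i ∙ σ)))
        ≡⟨ ∑-cong (λ σ → *-distribˡ-∑ (k σ) (λ i → leader (h i ∙ σ))) ⟩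
      ∑ (λ σ → ∑ (λ i → k σ * leader (h i ∙ σ)))
        ≡⟨ ∑-comm (λ σ i → k σ * leader (h i ∙ σ)) ⟩
      ∑ (λ i → ∑ (λ σ → k σ * leader (h i ∙ σ)))
        ≡⟨ ∑-cong (λ i → ∑-translate (h i ⁻¹) (λ σ → k σ * leader (h i ∙ σ))) ⟩
      ∑ (λ i → ∑ (λ σ → k ((h i ⁻¹) ∙ σ) * leader (h i ∙ ((h i ⁻¹) ∙ σ))))
        ≡⟨ ∑-cong (λ i → ∑-cong (λ σ →
             cong (λ τ → k ((h i ⁻¹) ∙ σ) * leader τ) (\\-leftDividesˡ (h i) σ))) ⟩
      ∑ (λ i → ∑ (λ σ → k ((h i ⁻¹) ∙ σ) * leader σ))
        ≡⟨ ∑-comm (λ i σ → k ((h i ⁻¹) ∙ σ) * leader σ) ⟩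
      ∑ (λ σ → ∑ (λ i → k ((h i ⁻¹) ∙ σ) * leader σ))
        ≡⟨ ∑-cong (λ σ → trans (sym (*-distribʳ-∑ (leader σ) (λ i → k ((h i ⁻¹) ∙ σ))))
                                (ℤ.*-comm _ (leader σ))) ⟩
      ∑ (λ σ → leader σ * ∑ (λ i → k ((h i ⁻¹) ∙ σ)))
        ∎
      where open ≡-Reasoning

    ∣coset-sums⇒∣∑ : ∀ (m : ℤ) (k : Fin N → ℤ) →
                     (∀ σ → m ∣ ∑ (λ i → k ((h i ⁻¹) ∙ σ))) → m ∣ ∑ k
    ∣coset-sums⇒∣∑ m k m∣coset-sum =
      subst (m ∣_) (sym (∑-by-cosets k)) (∣-∑ (λ σ → ∣n⇒∣m*n (leader σ) (m∣coset-sum σ)))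

module FinAbGroup2Properties {n : ℕ} (G : FinAbGroup2 n) where
  open import Data.Nat as ℕ using (zero; suc)
  import Data.Nat.Properties as ℕ
  open import Data.Integer using (ℤ; +_; _+_; _-_; _*_)
  import Data.Integer.Properties as ℤ
  open import Data.Integer.Divisibility.Signed using (_∣_; ∣-refl; ∣m∣n⇒∣m+n; ∣m⇒∣m*n; *-monoʳ-∣)
  open import Data.Integer.Tactic.RingSolver using (solve-∀)
  open import Data.Fin as Fin using (zero; toℕ; fromℕ<; splitAt; join)
  open import Data.Fin.Properties
    using (toℕ<n; toℕ-fromℕ<; toℕ-injective; splitAt-join; join-splitAt; splitAt-↑ˡ; splitAt-↑ʳ)
  open import Data.Product using (∃; _×_; _,_; proj₁; proj₂)
  open import Data.Sum using (_⊎_; inj₁; inj₂)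
  open import Algebra.Bundles using (AbelianGroup)
  import Algebra.Properties.Group as GroupProperties
  import Algebra.Properties.CommutativeSemigroup as CommutativeSemigroupProperties
  open import Algebra.Structures using (IsAbelianGroup)
  open import Function.Definitions using (Injective)
  open import Relation.Nullary using (¬_; Dec; yes; no; contradiction; _⊎-dec_)
  open import Relation.Binary.PropositionalEquality
  open FiniteSums
  open Divisibility using (∣-zero; ∣-flip; ∣-∑)
  open Minima using (least-witness)

  open FinAbGroup2 G

  𝔾 : Set
  𝔾 = Fin (2 ℕ.* n)

  open IsAbelianGroup isAbelianGroup using (isGroup; assoc; identityˡ; identityʳ)

  abelianGroup : AbelianGroup _ _
  abelianGroup = record
    { Carrier = 𝔾 ; _≈_ = _≡_ ; _∙_ = _∙_ ; ε = ε ; _⁻¹ = _⁻¹ ; isAbelianGroup = isAbelianGroup }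

  open AbelianGroup abelianGroup using (group; commutativeSemigroup)
  open GroupProperties group using (∙-cancelʳ; inverseʳ-unique; ⁻¹-anti-homo-∙; ε⁻¹≈ε; \\-leftDividesˡ)
  open CommutativeSemigroupProperties commutativeSemigroup
    using (interchange; x∙yz≈xz∙y; xy∙z≈x∙zy; xy∙z≈y∙xz)
  open FinGroups isGroup using (_^_; ^-+; ∃-period; module Cosets)

  u∙u∙ : ∀ σ → u ∙ (u ∙ σ) ≡ σ
  u∙u∙ σ = trans (sym (assoc u u σ)) (trans (cong (_∙ σ) u∙u≡ε) (identityˡ σ))

  u∙σ≢σ : ∀ σ → u ∙ σ ≢ σ
  u∙σ≢σ σ u∙σ≡σ = u≢ε (∙-cancelʳ σ u ε (trans u∙σ≡σ (sym (identityˡ σ))))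

  u⁻¹≡u : u ⁻¹ ≡ u
  u⁻¹≡u = sym (inverseʳ-unique u u u∙u≡ε)

  _∈⟨u⟩ : 𝔾 → Set
  g ∈⟨u⟩ = g ≡ ε ⊎ g ≡ u

  _∈⟨u⟩? : ∀ g → Dec (g ∈⟨u⟩)
  g ∈⟨u⟩? = (g Fin.≟ ε) ⊎-dec (g Fin.≟ u)

  ∉⟨u⟩ : ∀ {σ} → σ ≢ ε → σ ≢ u → ¬ σ ∈⟨u⟩
  ∉⟨u⟩ σ≢ε σ≢u (inj₁ σ≡ε) = σ≢ε σ≡ε
  ∉⟨u⟩ σ≢ε σ≢u (inj₂ σ≡u) = σ≢u σ≡u

  ∈⟨u⟩-∙ : ∀ {g g′} → g ∈⟨u⟩ → g′ ∈⟨u⟩ → (g ∙ g′) ∈⟨u⟩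
  ∈⟨u⟩-∙ (inj₁ refl) g′∈⟨u⟩    = subst _∈⟨u⟩ (sym (identityˡ _)) g′∈⟨u⟩
  ∈⟨u⟩-∙ (inj₂ refl) (inj₁ refl) = inj₂ (identityʳ u)
  ∈⟨u⟩-∙ (inj₂ refl) (inj₂ refl) = inj₁ u∙u≡ε

  ∈⟨u⟩-u∙ : ∀ {σ} → (u ∙ σ) ∈⟨u⟩ → σ ∈⟨u⟩
  ∈⟨u⟩-u∙ {σ} u∙σ∈⟨u⟩ = subst _∈⟨u⟩ (u∙u∙ σ) (∈⟨u⟩-∙ (inj₂ refl) u∙σ∈⟨u⟩)

  ∈⟨u⟩-cancel : ∀ {c} → c ∈⟨u⟩ → ∀ g → c ∙ (c ∙ g) ≡ g
  ∈⟨u⟩-cancel (inj₁ refl) g = trans (identityˡ _) (identityˡ g)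
  ∈⟨u⟩-cancel (inj₂ refl) g = u∙u∙ g

  ∈⟨u⟩-inverse : ∀ {c} → c ∈⟨u⟩ → c ⁻¹ ≡ c
  ∈⟨u⟩-inverse (inj₁ refl) = ε⁻¹≈ε
  ∈⟨u⟩-inverse (inj₂ refl) = u⁻¹≡u

  module OrderModulo⟨u⟩ (τ : 𝔾) (τ∉⟨u⟩ : ¬ τ ∈⟨u⟩) where

    opaque
      least-period : ∃ λ r → (τ ^ suc r) ∈⟨u⟩ × (∀ {k} → k ℕ.< r → ¬ (τ ^ suc k) ∈⟨u⟩)
      least-period =
        least-witness (λ k → (τ ^ suc k) ∈⟨u⟩?) {proj₁ (∃-period τ)} (inj₁ (proj₂ (∃-period τ)))

    r : ℕ
    r = proj₁ least-period

    R : ℕ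
    R = suc r

    τ^R∈⟨u⟩ : (τ ^ R) ∈⟨u⟩
    τ^R∈⟨u⟩ = proj₁ (proj₂ least-period)

    τ^k∉⟨u⟩ : ∀ {k} → k ℕ.< r → ¬ (τ ^ suc k) ∈⟨u⟩
    τ^k∉⟨u⟩ = proj₂ (proj₂ least-period)

    1<R : 1 ℕ.< R
    1<R with r in r≡
    ... | zero  =
      contradiction (subst _∈⟨u⟩ (identityʳ τ) (subst (λ k → (τ ^ suc k) ∈⟨u⟩) r≡ τ^R∈⟨u⟩)) τ∉⟨u⟩
    ... | suc _ = ℕ.s≤s (ℕ.s≤s ℕ.z≤n)

    -- H = ⟨u, τ⟩ consists of the elements c τʲ with c ∈ ⟨u⟩ and j < R; inj₁ j stands for
    -- τʲ and inj₂ j for u τʲ.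
    Index : Set
    Index = Fin R ⊎ Fin R

    sign : Index → 𝔾
    sign (inj₁ _) = ε
    sign (inj₂ _) = u

    exponent : Index → ℕ
    exponent (inj₁ j) = toℕ j
    exponent (inj₂ j) = toℕ j

    element : Index → 𝔾
    element x = sign x ∙ (τ ^ exponent x)

    sign∈⟨u⟩ : ∀ x → sign x ∈⟨u⟩
    sign∈⟨u⟩ (inj₁ _) = inj₁ refl
    sign∈⟨u⟩ (inj₂ _) = inj₂ refl

    exponent<R : ∀ x → exponent x ℕ.< R
    exponent<R (inj₁ j) = toℕ<n j
    exponent<R (inj₂ j) = toℕ<n j

    with-sign : ∀ {c} → c ∈⟨u⟩ → Fin R → Index
    with-sign (inj₁ _) = inj₁
    with-sign (inj₂ _) = inj₂

    element-with-sign : ∀ {c} (c∈⟨u⟩ : c ∈⟨u⟩) j → element (with-sign c∈⟨u⟩ j) ≡ c ∙ (τ ^ toℕ j)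
    element-with-sign (inj₁ refl) j = refl
    element-with-sign (inj₂ refl) j = refl

    element-∙τ : ∀ x → ∃ λ y → element x ∙ τ ≡ element y
    element-∙τ x with suc (exponent x) ℕ.<? R
    ... | yes 1+e<R = with-sign (sign∈⟨u⟩ x) j , (begin
      element x ∙ τ                      ≡⟨ xy∙z≈x∙zy (sign x) (τ ^ exponent x) τ ⟩
      sign x ∙ (τ ^ suc (exponent x))    ≡⟨ cong (λ k → sign x ∙ (τ ^ k)) (sym (toℕ-fromℕ< 1+e<R)) ⟩
      sign x ∙ (τ ^ toℕ j)               ≡⟨ sym (element-with-sign (sign∈⟨u⟩ x) j) ⟩
      element (with-sign (sign∈⟨u⟩ x) j) ∎)
      where
      open ≡-Reasoning
      j : Fin R
      j = fromℕ< 1+e<R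
    ... | no  1+e≮R = with-sign c∈⟨u⟩ zero , (begin
      element x ∙ τ                                     ≡⟨ xy∙z≈x∙zy (sign x) (τ ^ exponent x) τ ⟩
      sign x ∙ (τ ^ suc (exponent x))                   ≡⟨ cong (λ k → sign x ∙ (τ ^ k)) 1+e≡R ⟩
      sign x ∙ (τ ^ R)                                  ≡⟨ sym (identityʳ _) ⟩
      (sign x ∙ (τ ^ R)) ∙ ε                            ≡⟨ sym (element-with-sign c∈⟨u⟩ zero) ⟩
      element (with-sign c∈⟨u⟩ zero)                    ∎)
      where
      open ≡-Reasoning
      1+e≡R : suc (exponent x) ≡ R
      1+e≡R = ℕ.≤-antisym (exponent<R x) (ℕ.≮⇒≥ 1+e≮R)
      c∈⟨u⟩ : (sign x ∙ (τ ^ R)) ∈⟨u⟩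
      c∈⟨u⟩ = ∈⟨u⟩-∙ (sign∈⟨u⟩ x) τ^R∈⟨u⟩

    normal-form : ∀ m {c} → c ∈⟨u⟩ → ∃ λ x → c ∙ (τ ^ m) ≡ element x
    normal-form zero        c∈⟨u⟩ = with-sign c∈⟨u⟩ zero , sym (element-with-sign c∈⟨u⟩ zero)
    normal-form (suc m) {c} c∈⟨u⟩ with normal-form m c∈⟨u⟩
    ... | x , c∙τᵐ≡x with element-∙τ x
    ...   | y , x∙τ≡y = y , trans (x∙yz≈xz∙y c τ (τ ^ m)) (trans (cong (_∙ τ) c∙τᵐ≡x) x∙τ≡y)

    element-closed : ∀ x y → ∃ λ z → element x ∙ element y ≡ element z
    element-closed x y with normal-form (exponent x ℕ.+ exponent y) (∈⟨u⟩-∙ (sign∈⟨u⟩ x) (sign∈⟨u⟩ y))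
    ... | z , eq = z , trans (interchange (sign x) (τ ^ exponent x) (sign y) (τ ^ exponent y))
                             (trans (cong ((sign x ∙ sign y) ∙_) (sym (^-+ τ (exponent x) (exponent y)))) eq)

    private
      exponent-unique-≤ : ∀ {c c′ i j} → c ∈⟨u⟩ → c′ ∈⟨u⟩ → i ℕ.≤ j → j ℕ.< R →
                          c ∙ (τ ^ i) ≡ c′ ∙ (τ ^ j) → i ≡ j
      exponent-unique-≤ {c} {c′} {i} {j} c∈⟨u⟩ c′∈⟨u⟩ i≤j j<R eq with j ℕ.∸ i in j∸i≡
      ... | zero  = ℕ.≤-antisym i≤j (ℕ.m∸n≡0⇒m≤n j∸i≡)
      ... | suc k = contradiction τ^[1+k]∈⟨u⟩ (τ^k∉⟨u⟩ k<r)
        where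
        k<r : k ℕ.< r
        k<r = ℕ.s≤s⁻¹ (ℕ.≤-<-trans (subst (ℕ._≤ j) j∸i≡ (ℕ.m∸n≤m j i)) j<R)
        τʲ≡ : τ ^ j ≡ (τ ^ suc k) ∙ (τ ^ i)
        τʲ≡ = trans (cong (τ ^_) (trans (sym (ℕ.m∸n+n≡m i≤j)) (cong (ℕ._+ i) j∸i≡))) (^-+ τ (suc k) i)
        c≡ : c ≡ c′ ∙ (τ ^ suc k)
        c≡ = ∙-cancelʳ (τ ^ i) c (c′ ∙ (τ ^ suc k))
                       (trans eq (trans (cong (c′ ∙_) τʲ≡) (sym (assoc c′ (τ ^ suc k) (τ ^ i)))))
        τ^[1+k]∈⟨u⟩ : (τ ^ suc k) ∈⟨u⟩
        τ^[1+k]∈⟨u⟩ = subst _∈⟨u⟩ (trans (cong (c′ ∙_) c≡) (∈⟨u⟩-cancel c′∈⟨u⟩ (τ ^ suc k)))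
                            (∈⟨u⟩-∙ c′∈⟨u⟩ c∈⟨u⟩)

    exponent-unique : ∀ {c c′ i j} → c ∈⟨u⟩ → c′ ∈⟨u⟩ → i ℕ.< R → j ℕ.< R →
                      c ∙ (τ ^ i) ≡ c′ ∙ (τ ^ j) → i ≡ j
    exponent-unique {i = i} {j} c∈⟨u⟩ c′∈⟨u⟩ i<R j<R eq with ℕ.≤-total i j
    ... | inj₁ i≤j = exponent-unique-≤ c∈⟨u⟩ c′∈⟨u⟩ i≤j j<R eq
    ... | inj₂ j≤i = sym (exponent-unique-≤ c′∈⟨u⟩ c∈⟨u⟩ j≤i i<R (sym eq))

    element-injective : Injective _≡_ _≡_ element
    element-injective {x} {y} eq = same-index x y (∙-cancelʳ (τ ^ exponent x) (sign x) (sign y) signs) exponents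
      where
      exponents : exponent x ≡ exponent y
      exponents = exponent-unique (sign∈⟨u⟩ x) (sign∈⟨u⟩ y) (exponent<R x) (exponent<R y) eq
      signs : sign x ∙ (τ ^ exponent x) ≡ sign y ∙ (τ ^ exponent x)
      signs = trans eq (cong (λ k → sign y ∙ (τ ^ k)) (sym exponents))
      same-index : ∀ x y → sign x ≡ sign y → exponent x ≡ exponent y → x ≡ y
      same-index (inj₁ a) (inj₁ b) _   a≡b = cong inj₁ (toℕ-injective a≡b)
      same-index (inj₁ a) (inj₂ b) ε≡u _   = contradiction (sym ε≡u) u≢ε
      same-index (inj₂ a) (inj₁ b) u≡ε _   = contradiction u≡ε u≢ε
      same-index (inj₂ a) (inj₂ b) _   a≡b = cong inj₂ (toℕ-injective a≡b)

    h : Fin (R ℕ.+ R) → 𝔾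
    h i = element (splitAt R i)

    h-injective : Injective _≡_ _≡_ h
    h-injective {i} {j} eq = trans (sym (join-splitAt R R i))
      (trans (cong (join R R) (element-injective {splitAt R i} {splitAt R j} eq)) (join-splitAt R R j))

    h-closed : ∀ i j → ∃ λ l → h i ∙ h j ≡ h l
    h-closed i j with element-closed (splitAt R i) (splitAt R j)
    ... | z , eq = join R R z , trans eq (cong element (sym (splitAt-join R R z)))

    open Cosets h h-injective h-closed using (∣coset-sums⇒∣∑)

    2R∣∑ : ∀ (k : 𝔾 → ℤ) → (∀ σ → k (u ∙ σ) ≡ k σ) → (∀ σ → + R ∣ k (τ ∙ σ) - k σ) →
           + 2 * + R ∣ ∑ k
    2R∣∑ k k-u∙ R∣k-τ∙ = ∣coset-sums⇒∣∑ (+ 2 * + R) k coset-sum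
      where
      k-∈⟨u⟩∙ : ∀ {c} → c ∈⟨u⟩ → ∀ σ → k (c ∙ σ) ≡ k σ
      k-∈⟨u⟩∙ (inj₁ refl) σ = cong k (identityˡ σ)
      k-∈⟨u⟩∙ (inj₂ refl) σ = k-u∙ σ

      k-element : ∀ x σ → k ((element x ⁻¹) ∙ σ) ≡ k (((τ ^ exponent x) ⁻¹) ∙ σ)
      k-element x σ = trans (cong k (begin
        (element x ⁻¹) ∙ σ            ≡⟨ cong (_∙ σ) (⁻¹-anti-homo-∙ (sign x) t) ⟩
        ((t ⁻¹) ∙ (sign x ⁻¹)) ∙ σ    ≡⟨ cong (λ c → ((t ⁻¹) ∙ c) ∙ σ) (∈⟨u⟩-inverse (sign∈⟨u⟩ x)) ⟩
        ((t ⁻¹) ∙ sign x) ∙ σ         ≡⟨ xy∙z≈y∙xz (t ⁻¹) (sign x) σ ⟩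
        sign x ∙ ((t ⁻¹) ∙ σ)         ∎))
        (k-∈⟨u⟩∙ (sign∈⟨u⟩ x) ((t ⁻¹) ∙ σ))
        where
        open ≡-Reasoning
        t : 𝔾
        t = τ ^ exponent x

      R∣k-τ^∙ : ∀ j σ → + R ∣ k ((τ ^ j) ∙ σ) - k σ
      R∣k-τ^∙ zero    σ =
        subst (+ R ∣_) (sym (trans (cong (λ x → k x - k σ) (identityˡ σ)) (ℤ.+-inverseʳ (k σ)))) (∣-zero (+ R))
      R∣k-τ^∙ (suc j) σ = subst (+ R ∣_) telescope (∣m∣n⇒∣m+n (R∣k-τ∙ x) (R∣k-τ^∙ j σ))
        where
        x : 𝔾
        x = (τ ^ j) ∙ σ
        cancel : ∀ a b c → a - b + (b - c) ≡ a - c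
        cancel = solve-∀
        telescope : k (τ ∙ x) - k x + (k x - k σ) ≡ k ((τ ^ suc j) ∙ σ) - k σ
        telescope = trans (cancel (k (τ ∙ x)) (k x) (k σ)) (cong (λ y → k y - k σ) (sym (assoc τ (τ ^ j) σ)))

      coset-sum : ∀ σ → + 2 * + R ∣ ∑ (λ i → k ((h i ⁻¹) ∙ σ))
      coset-sum σ = subst (_ ∣_) (sym coset-sum≡2S) (*-monoʳ-∣ (+ 2) R∣S)
        where
        S : ℤ
        S = ∑ (λ (j : Fin R) → k (((τ ^ toℕ j) ⁻¹) ∙ σ))

        term : Index → ℤ
        term x = k ((element x ⁻¹) ∙ σ)

        coset-sum≡2S : ∑ (λ i → k ((h i ⁻¹) ∙ σ)) ≡ + 2 * S
        coset-sum≡2S = trans (∑-++ {R} {R} (λ i → k ((h i ⁻¹) ∙ σ)))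
          (trans (cong₂ _+_ (∑-cong (λ j → trans (cong term (splitAt-↑ˡ R j R)) (k-element (inj₁ j) σ)))
                            (∑-cong (λ j → trans (cong term (splitAt-↑ʳ R R j)) (k-element (inj₂ j) σ))))
                 (double S))
          where
          double : ∀ S → S + S ≡ + 2 * S
          double = solve-∀

        R∣S : + R ∣ S
        R∣S = subst (+ R ∣_) split (∣m∣n⇒∣m+n (∣-∑ R∣kⱼ-kσ) (∣m⇒∣m*n (k σ) ∣-refl))
          where
          R∣kⱼ-kσ : ∀ (j : Fin R) → + R ∣ k (((τ ^ toℕ j) ⁻¹) ∙ σ) - k σ
          R∣kⱼ-kσ j = ∣-flip (k σ) (k x) (subst (λ y → + R ∣ k y - k x) (\\-leftDividesˡ (τ ^ toℕ j) σ)
                                                (R∣k-τ^∙ (toℕ j) x))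
            where
            x : 𝔾
            x = ((τ ^ toℕ j) ⁻¹) ∙ σ
          cancel : ∀ a b → a - b + b ≡ a
          cancel = solve-∀
          split : ∑ (λ (j : Fin R) → k (((τ ^ toℕ j) ⁻¹) ∙ σ) - k σ) + + R * k σ ≡ S
          split = trans (cong (_+ + R * k σ)
                              (trans (∑-distrib-minus (λ (j : Fin R) → k (((τ ^ toℕ j) ⁻¹) ∙ σ)) (λ _ → k σ))
                                     (cong (_-_ S) (∑-const {R} (k σ)))))
                        (cancel S (+ R * k σ))

module GLatticeProperties {n : ℕ} {G : FinAbGroup2 n} (L : GLattice G) where
  open import Data.Nat as ℕ using (zero; suc)
  import Data.Nat.Properties as ℕ
  open import Data.Integer as ℤ using (ℤ; +_; -_; -[1+_]; _+_; _-_; _*_; 0ℤ; 1ℤ)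
  import Data.Integer.Properties as ℤ
  open import Data.Integer.Divisibility.Signed using (_∣_; ∣m⇒∣-m)
  open import Data.Integer.Tactic.RingSolver using (solve-∀)
  import Data.Fin as Fin
  open import Data.Fin.Properties using (any?; <-asym; <-cmp)
  open import Data.Product using (∃; _,_; proj₁; proj₂)
  open import Data.Sum using (_⊎_; inj₁; inj₂)
  open import Algebra.Bundles using (AbelianGroup)
  open import Algebra.Structures using (IsAbelianGroup)
  import Algebra.Properties.Group as GroupProperties
  open import Function using (_∘_)
  open import Function.Bundles using (_⇔_; mk⇔)
  open import Relation.Nullary using (¬_; yes; no; ¬?; contradiction; _⊎-dec_)
  open import Relation.Binary.PropositionalEquality
  open import Relation.Binary.Definitions using (tri<; tri≈; tri>)
  open FiniteSums
  open LinearCombinations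
  open Involutions using (Pairing; pairing)
  open FinAbGroup2Properties G

  open FinAbGroup2 G
  open GLattice L
  open IsAbelianGroup isAbelianGroup using (identityˡ)
  open GroupProperties (AbelianGroup.group abelianGroup) using (∙-cancelˡ; ε⁻¹≈ε)

  covector : Vec n → Vec n
  covector x j = ∑ (λ i → x i * gram i j)

  ⟨⟩≡dot : ∀ x y → ⟨ x , y ⟩ ≡ dot (covector x) y
  ⟨⟩≡dot x y = trans (∑-comm (λ i j → x i * gram i j * y j))
                     (∑-cong (λ j → sym (*-distribʳ-∑ (y j) (λ i → x i * gram i j))))

  ⟨⟩-sym : ∀ x y → ⟨ x , y ⟩ ≡ ⟨ y , x ⟩
  ⟨⟩-sym x y = trans (∑-comm (λ i j → x i * gram i j * y j)) (∑-cong (λ j → ∑-cong (λ i →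
    trans (cong (λ g → x i * g * y j) (gram-sym i j)) (reverse (x i) (gram j i) (y j)))))
    where
    reverse : ∀ a b c → a * b * c ≡ c * b * a
    reverse = solve-∀

  ⟨⟩-cong : ∀ {x x′ y y′} → x ≗ x′ → y ≗ y′ → ⟨ x , y ⟩ ≡ ⟨ x′ , y′ ⟩
  ⟨⟩-cong x≗x′ y≗y′ =
    ∑-cong (λ i → ∑-cong (λ j → cong₂ (λ a b → a * gram i j * b) (x≗x′ i) (y≗y′ j)))

  ⟨⟩-congʳ : ∀ x {y y′} → y ≗ y′ → ⟨ x , y ⟩ ≡ ⟨ x , y′ ⟩
  ⟨⟩-congʳ x = ⟨⟩-cong {x} {x} (λ _ → refl)

  ⟨⟩-lincombʳ : ∀ {k} x (c : Fin k → ℤ) v → ⟨ x , lincomb c v ⟩ ≡ ∑ (λ t → c t * ⟨ x , v t ⟩)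
  ⟨⟩-lincombʳ x c v = trans (⟨⟩≡dot x (lincomb c v))
    (trans (dot-lincomb (covector x) c v) (∑-cong (λ t → cong (c t *_) (sym (⟨⟩≡dot x (v t))))))

  ⟨⟩-+ʳ : ∀ x y z → ⟨ x , y +ᵥ z ⟩ ≡ ⟨ x , y ⟩ + ⟨ x , z ⟩
  ⟨⟩-+ʳ x y z = trans (⟨⟩≡dot x (y +ᵥ z))
    (trans (dot-+ (covector x) y z) (sym (cong₂ _+_ (⟨⟩≡dot x y) (⟨⟩≡dot x z))))

  ⟨⟩-scaleʳ : ∀ x m y → ⟨ x , m ·ᵥ y ⟩ ≡ m * ⟨ x , y ⟩
  ⟨⟩-scaleʳ x m y = trans (⟨⟩≡dot x (m ·ᵥ y))
    (trans (dot-scale (covector x) m y) (cong (m *_) (sym (⟨⟩≡dot x y))))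

  ⟨⟩-negʳ : ∀ x y → ⟨ x , -ᵥ y ⟩ ≡ - ⟨ x , y ⟩
  ⟨⟩-negʳ x y = trans (⟨⟩≡dot x (-ᵥ y)) (trans (dot-neg (covector x) y) (cong -_ (sym (⟨⟩≡dot x y))))

  ⟨⟩-minusʳ : ∀ x y z → ⟨ x , y -ᵥ z ⟩ ≡ ⟨ x , y ⟩ - ⟨ x , z ⟩
  ⟨⟩-minusʳ x y z = trans (⟨⟩≡dot x (y -ᵥ z))
    (trans (dot-minus (covector x) y z) (sym (cong₂ _-_ (⟨⟩≡dot x y) (⟨⟩≡dot x z))))

  ⟨⟩-minusˡ : ∀ x y z → ⟨ x -ᵥ y , z ⟩ ≡ ⟨ x , z ⟩ - ⟨ y , z ⟩
  ⟨⟩-minusˡ x y z =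
    trans (⟨⟩-sym (x -ᵥ y) z) (trans (⟨⟩-minusʳ z x y) (cong₂ _-_ (⟨⟩-sym z x) (⟨⟩-sym z y)))

  ⋆-cong : ∀ (A : Matrix n) {x y} → x ≗ y → A ⋆ x ≗ A ⋆ y
  ⋆-cong A x≗y i = ∑-cong (λ j → cong (A i j *_) (x≗y j))

  ⋆-lincomb+scale : ∀ {k} (A : Matrix n) (c : Fin k → ℤ) v m y →
                    A ⋆ (lincomb c v +ᵥ m ·ᵥ y) ≗ lincomb c (λ t → A ⋆ v t) +ᵥ m ·ᵥ (A ⋆ y)
  ⋆-lincomb+scale A c v m y i =
    trans (dot-+ (A i) (lincomb c v) (m ·ᵥ y)) (cong₂ _+_ (dot-lincomb (A i) c v) (dot-scale (A i) m y))

  ρ-u∙ : ∀ σ x → ρ (u ∙ σ) ⋆ x ≗ -ᵥ (ρ σ ⋆ x)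
  ρ-u∙ σ x i = trans (act-∙ u σ x i) (act-u (ρ σ ⋆ x) i)

  ⟨x,x⟩≡0⇒x≗0 : ∀ x → ⟨ x , x ⟩ ≡ 0ℤ → ∀ i → x i ≡ 0ℤ
  ⟨x,x⟩≡0⇒x≗0 x ⟨x,x⟩≡0 i with x i ℤ.≟ 0ℤ
  ... | yes xi≡0 = xi≡0
  ... | no  xi≢0 = contradiction (subst (0ℤ ℤ.<_) ⟨x,x⟩≡0 (gram-posdef x (i , xi≢0))) (ℤ.<-irrefl refl)

  x≗0⇒⟨x,x⟩≡0 : ∀ x → (∀ i → x i ≡ 0ℤ) → ⟨ x , x ⟩ ≡ 0ℤ
  x≗0⇒⟨x,x⟩≡0 x x≗0 = ∑-zero (λ i → ∑-zero (λ j → cong (λ a → a * gram i j * x j) (x≗0 i)))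

  0≤⟨x,x⟩ : ∀ x → 0ℤ ℤ.≤ ⟨ x , x ⟩
  0≤⟨x,x⟩ x with any? (λ i → ¬? (x i ℤ.≟ 0ℤ))
  ... | yes nonzero = ℤ.<⇒≤ (gram-posdef x nonzero)
  ... | no  ¬nonzero = ℤ.≤-reflexive (sym (x≗0⇒⟨x,x⟩≡0 x x≗0))
    where
    x≗0 : ∀ i → x i ≡ 0ℤ
    x≗0 i with x i ℤ.≟ 0ℤ
    ... | yes xi≡0 = xi≡0
    ... | no  xi≢0 = contradiction (i , xi≢0) ¬nonzero

  ⟨x-y,x-y⟩ : ∀ x y → ⟨ x -ᵥ y , x -ᵥ y ⟩ ≡ ⟨ x , x ⟩ - + 2 * ⟨ x , y ⟩ + ⟨ y , y ⟩
  ⟨x-y,x-y⟩ x y = begin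
    ⟨ x -ᵥ y , x -ᵥ y ⟩
      ≡⟨ ⟨⟩-minusˡ x y (x -ᵥ y) ⟩
    ⟨ x , x -ᵥ y ⟩ - ⟨ y , x -ᵥ y ⟩
      ≡⟨ cong₂ _-_ (⟨⟩-minusʳ x x y) (⟨⟩-minusʳ y x y) ⟩
    ⟨ x , x ⟩ - ⟨ x , y ⟩ - (⟨ y , x ⟩ - ⟨ y , y ⟩)
      ≡⟨ cong (λ a → ⟨ x , x ⟩ - ⟨ x , y ⟩ - (a - ⟨ y , y ⟩)) (⟨⟩-sym y x) ⟩
    ⟨ x , x ⟩ - ⟨ x , y ⟩ - (⟨ x , y ⟩ - ⟨ y , y ⟩)
      ≡⟨ collect ⟨ x , x ⟩ ⟨ x , y ⟩ ⟨ y , y ⟩ ⟩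
    ⟨ x , x ⟩ - + 2 * ⟨ x , y ⟩ + ⟨ y , y ⟩
      ∎
    where
    open ≡-Reasoning
    collect : ∀ a b c → a - b - (b - c) ≡ a - + 2 * b + c
    collect = solve-∀

  short-neg : ∀ f → short f → short (-ᵥ f)
  short-neg f short-f = trans (⟨⟩-negʳ (-ᵥ f) f)
    (trans (cong -_ (trans (⟨⟩-sym (-ᵥ f) f) (⟨⟩-negʳ f f))) (trans (ℤ.neg-involutive _) short-f))

  private
    ⟨e-f,e-f⟩ : ∀ e f → short e → short f → ⟨ e -ᵥ f , e -ᵥ f ⟩ ≡ + 2 - + 2 * ⟨ e , f ⟩
    ⟨e-f,e-f⟩ e f short-e short-f = trans (⟨x-y,x-y⟩ e f)
      (trans (cong₂ (λ a b → a - + 2 * ⟨ e , f ⟩ + b) short-e short-f) (collect ⟨ e , f ⟩))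
      where
      collect : ∀ k → + 1 - + 2 * k + + 1 ≡ + 2 - + 2 * k
      collect = solve-∀

    ⟨e,f⟩≡1⇒f≗e : ∀ e f → short e → short f → ⟨ e , f ⟩ ≡ 1ℤ → f ≗ e
    ⟨e,f⟩≡1⇒f≗e e f short-e short-f ⟨e,f⟩≡1 i = sym (ℤ.i-j≡0⇒i≡j (e i) (f i)
      (⟨x,x⟩≡0⇒x≗0 (e -ᵥ f) (trans (⟨e-f,e-f⟩ e f short-e short-f) (cong (λ k → + 2 - + 2 * k) ⟨e,f⟩≡1)) i))

    ⟨e,f⟩≢2+t : ∀ e f {t} → short e → short f → ⟨ e , f ⟩ ≢ + suc (suc t)
    ⟨e,f⟩≢2+t e f {t} short-e short-f ⟨e,f⟩≡2+t
      with subst (0ℤ ℤ.≤_) (trans (⟨e-f,e-f⟩ e f short-e short-f)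
                                  (trans (cong (λ k → + 2 - + 2 * k) ⟨e,f⟩≡2+t) (negative (+ t))))
                 (0≤⟨x,x⟩ (e -ᵥ f))
      where
      negative : ∀ t → + 2 - + 2 * (+ 2 + t) ≡ - (+ 2 + (t + t))
      negative = solve-∀
    ... | ()

  -- Positive definiteness applied to e ∓ f: ⟨e ∓ f, e ∓ f⟩ = 2 ∓ 2⟨e, f⟩.
  unit-vectors : ∀ e f → short e → short f → ⟨ e , f ⟩ ≡ 0ℤ ⊎ f ≗ e ⊎ f ≗ -ᵥ e
  unit-vectors e f short-e short-f with ⟨ e , f ⟩ in ⟨e,f⟩≡
  ... | + 0           = inj₁ refl
  ... | + 1           = inj₂ (inj₁ (⟨e,f⟩≡1⇒f≗e e f short-e short-f ⟨e,f⟩≡))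
  ... | + suc (suc t) = contradiction ⟨e,f⟩≡ (⟨e,f⟩≢2+t e f short-e short-f)
  ... | -[1+ 0 ]      = inj₂ (inj₂ λ i → trans (sym (ℤ.neg-involutive (f i)))
                          (cong -_ (⟨e,f⟩≡1⇒f≗e e (-ᵥ f) short-e (short-neg f short-f) ⟨e,-f⟩≡1 i)))
    where
    ⟨e,-f⟩≡1 : ⟨ e , -ᵥ f ⟩ ≡ 1ℤ
    ⟨e,-f⟩≡1 = trans (⟨⟩-negʳ e f) (cong -_ ⟨e,f⟩≡)
  ... | -[1+ suc t ]  = contradiction (trans (⟨⟩-negʳ e f) (cong -_ ⟨e,f⟩≡))
                                      (⟨e,f⟩≢2+t e (-ᵥ f) short-e (short-neg f short-f))

  u-moves-short : ∀ e → short e → ¬ (ρ u ⋆ e ≗ e)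
  u-moves-short e short-e ue≗e = contradiction (trans (sym short-e) (x≗0⇒⟨x,x⟩≡0 e e≗0)) (λ ())
    where
    self-negative⇒0 : ∀ {x} → - x ≡ x → x ≡ 0ℤ
    self-negative⇒0 {+ zero}    _ = refl
    self-negative⇒0 {+ suc _}   ()
    self-negative⇒0 { -[1+ _ ]} ()
    e≗0 : ∀ i → e i ≡ 0ℤ
    e≗0 i = self-negative⇒0 (trans (sym (act-u e i)) (ue≗e i))

  δ-same : ∀ g → δ g g ≡ 1ℤ
  δ-same g with g Fin.≟ g
  ... | yes _   = refl
  ... | no  g≢g = contradiction refl g≢g

  δ-diff : ∀ {g τ} → τ ≢ g → δ g τ ≡ 0ℤ
  δ-diff {g} {τ} τ≢g with τ Fin.≟ g
  ... | yes τ≡g = contradiction τ≡g τ≢g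
  ... | no  _   = refl

  ∑-δ : ∀ g (F : 𝔾 → ℤ) → ∑ (λ σ → δ g σ * F σ) ≡ F g
  ∑-δ g F = trans (∑-single g (λ σ σ≢g → trans (cong (_* F σ) (δ-diff σ≢g)) (ℤ.*-zeroˡ (F σ))))
                  (trans (cong (_* F g) (δ-same g)) (ℤ.*-identityˡ (F g)))

  ⊛-by-u+1 : ∀ h τ → ((δ u ⊕ δ ε) ⊛ h) τ ≡ h (u ∙ τ) + h τ
  ⊛-by-u+1 h τ = begin
    ∑ (λ σ → (δ u σ + δ ε σ) * H σ)
      ≡⟨ ∑-cong (λ σ → ℤ.*-distribʳ-+ (H σ) (δ u σ) (δ ε σ)) ⟩
    ∑ (λ σ → δ u σ * H σ + δ ε σ * H σ)
      ≡⟨ ∑-distrib-+ (λ σ → δ u σ * H σ) (λ σ → δ ε σ * H σ) ⟩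
    ∑ (λ σ → δ u σ * H σ) + ∑ (λ σ → δ ε σ * H σ)
      ≡⟨ cong₂ _+_ (∑-δ u H) (∑-δ ε H) ⟩
    h ((u ⁻¹) ∙ τ) + h ((ε ⁻¹) ∙ τ)
      ≡⟨ cong₂ (λ a b → h (a ∙ τ) + h b) u⁻¹≡u (trans (cong (_∙ τ) ε⁻¹≈ε) (identityˡ τ)) ⟩
    h (u ∙ τ) + h τ
      ∎
    where
    open ≡-Reasoning
    H : 𝔾 → ℤ
    H σ = h ((σ ⁻¹) ∙ τ)

  private
    halve : ∀ {h} → h ℕ.+ h ≡ 2 ℕ.* n → h ≡ n
    halve {h} h+h≡2n = ℕ.*-cancelˡ-≡ h n 2 (trans (cong (h ℕ.+_) (ℕ.+-identityʳ h)) h+h≡2n)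

    SplitsSums : ∀ {k} → (Fin k → 𝔾) → Set
    SplitsSums s = ∀ (F : 𝔾 → ℤ) → ∑ F ≡ ∑ (λ i → F (s i) + F (u ∙ s i))

  opaque
    reps : ∃ λ (s : Fin n → 𝔾) → SplitsSums s
    reps = reindex (Pairing.half+half u-pairs) (Pairing.rep u-pairs) (Pairing.∑-pairs u-pairs)
      where
      u-pairs : Pairing (u ∙_)
      u-pairs = pairing (u ∙_) u∙u∙ u∙σ≢σ
      reindex : ∀ {h} → h ℕ.+ h ≡ 2 ℕ.* n → (s : Fin h → 𝔾) → SplitsSums s →
                ∃ λ (s : Fin n → 𝔾) → SplitsSums s
      reindex {h} h+h≡2n s split with halve {h} h+h≡2n
      ... | refl = s , split

  rep : Fin n → 𝔾
  rep = proj₁ reps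

  ∑-by-reps : ∀ (F : 𝔾 → ℤ) → ∑ F ≡ ∑ (λ i → F (rep i) + F (u ∙ rep i))
  ∑-by-reps = proj₂ reps

  rep-covers : ∀ σ → ∃ λ i → σ ≡ rep i ⊎ σ ≡ u ∙ rep i
  rep-covers σ with any? (λ i → (σ Fin.≟ rep i) ⊎-dec (σ Fin.≟ u ∙ rep i))
  ... | yes covered = covered
  ... | no  missed  = contradiction (begin
    1ℤ                                        ≡⟨ sym (δ-same σ) ⟩
    δ σ σ                                     ≡⟨ sym (∑-single σ (λ _ → δ-diff)) ⟩
    ∑ (δ σ)                                   ≡⟨ ∑-by-reps (δ σ) ⟩
    ∑ (λ i → δ σ (rep i) + δ σ (u ∙ rep i))   ≡⟨ ∑-zero (λ i → cong₂ _+_ (δ-diff (missed ∘ (i ,_) ∘ inj₁ ∘ sym))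
                                                                        (δ-diff (missed ∘ (i ,_) ∘ inj₂ ∘ sym))) ⟩
    0ℤ                                        ∎) (λ ())
    where open ≡-Reasoning

  antisym : (𝔾 → ℤ) → 𝔾 → ℤ
  antisym c σ = c σ - c (u ∙ σ)

  antisym-u∙ : ∀ c σ → antisym c (u ∙ σ) ≡ - antisym c σ
  antisym-u∙ c σ = trans (cong (λ τ → c (u ∙ σ) - c τ) (u∙u∙ σ)) (swap (c (u ∙ σ)) (c σ))
    where
    swap : ∀ a b → a - b ≡ - (b - a)
    swap = solve-∀

  ∣-antisym-from-reps : ∀ m c c′ → (∀ i → m ∣ antisym c (rep i) - antisym c′ (rep i)) →
                        ∀ σ → m ∣ antisym c σ - antisym c′ σ
  ∣-antisym-from-reps m c c′ m∣at-reps σ with rep-covers σ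
  ... | i , inj₁ refl = m∣at-reps i
  ... | i , inj₂ refl = subst (m ∣_) (trans (negate (antisym c (rep i)) (antisym c′ (rep i)))
                                            (sym (cong₂ _-_ (antisym-u∙ c (rep i)) (antisym-u∙ c′ (rep i)))))
                              (∣m⇒∣-m (m∣at-reps i))
    where
    negate : ∀ a b → - (a - b) ≡ - a - - b
    negate = solve-∀

  ≈⟨G⟩⇔antisym-≗ : ∀ f g → f ≈⟨G⟩ g ⇔ antisym f ≗ antisym g
  ≈⟨G⟩⇔antisym-≗ f g = mk⇔ ≈⇒≗ ≗⇒≈
    where
    F : 𝔾 → ℤ
    F τ = f τ - g τ

    rearrange : ∀ a b c d → a - b ≡ c - d → a - c ≡ b - d
    rearrange a b c d eq = trans (step₁ a b c) (trans (cong (λ z → z + b - c) eq) (step₂ b c d))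
      where
      step₁ : ∀ a b c → a - c ≡ a - b + b - c
      step₁ = solve-∀
      step₂ : ∀ b c d → c - d + b - c ≡ b - d
      step₂ = solve-∀

    ≈⇒≗ : f ≈⟨G⟩ g → antisym f ≗ antisym g
    ≈⇒≗ (h , F≡) τ = rearrange (f τ) (g τ) (f (u ∙ τ)) (g (u ∙ τ)) (begin
      F τ                          ≡⟨ trans (F≡ τ) (⊛-by-u+1 h τ) ⟩
      h (u ∙ τ) + h τ              ≡⟨ ℤ.+-comm (h (u ∙ τ)) (h τ) ⟩
      h τ + h (u ∙ τ)              ≡⟨ cong (λ σ → h σ + h (u ∙ τ)) (sym (u∙u∙ τ)) ⟩
      h (u ∙ (u ∙ τ)) + h (u ∙ τ)  ≡⟨ sym (trans (F≡ (u ∙ τ)) (⊛-by-u+1 h (u ∙ τ))) ⟩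
      F (u ∙ τ)                    ∎)
      where open ≡-Reasoning

    ≗⇒≈ : antisym f ≗ antisym g → f ≈⟨G⟩ g
    ≗⇒≈ antisym≗ = half , λ τ → trans (F≡half τ) (sym (⊛-by-u+1 half τ))
      where
      F-u∙ : ∀ τ → F (u ∙ τ) ≡ F τ
      F-u∙ τ = sym (rearrange (f τ) (f (u ∙ τ)) (g τ) (g (u ∙ τ)) (antisym≗ τ))

      half : 𝔾 → ℤ
      half τ with τ Fin.<? u ∙ τ
      ... | yes _ = F τ
      ... | no  _ = 0ℤ

      F≡half : ∀ τ → F τ ≡ half (u ∙ τ) + half τ
      F≡half τ with τ Fin.<? u ∙ τ | u ∙ τ Fin.<? u ∙ (u ∙ τ)
      ... | yes τ<uτ | yes uτ<τ = contradiction (subst (u ∙ τ Fin.<_) (u∙u∙ τ) uτ<τ) (<-asym τ<uτ)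
      ... | yes _    | no  _    = sym (ℤ.+-identityˡ (F τ))
      ... | no  _    | yes _    = trans (sym (F-u∙ τ)) (sym (ℤ.+-identityʳ (F (u ∙ τ))))
      ... | no  τ≮uτ | no  uτ≮τ with <-cmp τ (u ∙ τ)
      ...   | tri< τ<uτ _ _ = contradiction τ<uτ τ≮uτ
      ...   | tri≈ _ τ≡uτ _ = contradiction (sym τ≡uτ) (u∙σ≢σ τ)
      ...   | tri> _ _ uτ<τ = contradiction (subst (u ∙ τ Fin.<_) (sym (u∙u∙ τ)) uτ<τ) uτ≮τ

  antisym-δε : ∀ τ → antisym (δ ε) τ ≡ δ ε τ - δ u τ
  antisym-δε τ = cong (_-_ (δ ε τ)) δε[u∙τ]≡δu[τ]
    where
    δε[u∙τ]≡δu[τ] : δ ε (u ∙ τ) ≡ δ u τ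
    δε[u∙τ]≡δu[τ] with τ Fin.≟ u
    ... | yes refl = trans (cong (δ ε) u∙u≡ε) (δ-same ε)
    ... | no  τ≢u  = δ-diff (λ u∙τ≡ε → τ≢u (∙-cancelˡ u τ u (trans u∙τ≡ε (sym u∙u≡ε))))

  module Lifted (s : Fin n → 𝔾) (s-reps : IsCosetReps s) (x y : Vec n) where

    private
      c : Fin n → ℤ
      c j = ⟨ x , ρ (s j) ⋆ y ⟩

    lifted-at-rep : ∀ i → lifted s x y (s i) ≡ c i
    lifted-at-rep i = trans
      (∑-single i (λ j j≢i →
        trans (cong (_* c j) (δ-diff (λ si≡sj → j≢i (sym (proj₂ s-reps i j (inj₁ si≡sj)))))) (ℤ.*-zeroˡ (c j))))
      (trans (cong (_* c i) (δ-same (s i))) (ℤ.*-identityˡ (c i)))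

    lifted-off-reps : ∀ {τ} → (∀ j → τ ≢ s j) → lifted s x y τ ≡ 0ℤ
    lifted-off-reps τ≢s = ∑-zero (λ j → trans (cong (_* c j) (δ-diff (τ≢s j))) (ℤ.*-zeroˡ (c j)))

    u∙s≢s : ∀ i j → u ∙ s i ≢ s j
    u∙s≢s i j u∙si≡sj with proj₂ s-reps j i (inj₂ (sym u∙si≡sj))
    ... | refl = u∙σ≢σ (s i) u∙si≡sj

    lifted-antisym : antisym (lifted s x y) ≗ (λ τ → ⟨ x , ρ τ ⋆ y ⟩)
    lifted-antisym τ with proj₁ s-reps τ
    ... | i , inj₁ refl = begin
      lifted s x y (s i) - lifted s x y (u ∙ s i)            ≡⟨ cong₂ _-_ (lifted-at-rep i)
                                                                          (lifted-off-reps (u∙s≢s i)) ⟩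
      ⟨ x , ρ (s i) ⋆ y ⟩ - 0ℤ                               ≡⟨ ℤ.+-identityʳ _ ⟩
      ⟨ x , ρ (s i) ⋆ y ⟩                                    ∎
      where open ≡-Reasoning
    ... | i , inj₂ refl = begin
      lifted s x y (u ∙ s i) - lifted s x y (u ∙ (u ∙ s i))  ≡⟨ cong₂ _-_ (lifted-off-reps (u∙s≢s i))
                                                                          (cong (lifted s x y) (u∙u∙ (s i))) ⟩
      0ℤ - lifted s x y (s i)                                ≡⟨ ℤ.+-identityˡ _ ⟩
      - lifted s x y (s i)                                   ≡⟨ cong -_ (lifted-at-rep i) ⟩
      - ⟨ x , ρ (s i) ⋆ y ⟩                                  ≡⟨ sym (⟨⟩-negʳ x (ρ (s i) ⋆ y)) ⟩
      ⟨ x , -ᵥ (ρ (s i) ⋆ y) ⟩                               ≡⟨ sym (⟨⟩-congʳ x (ρ-u∙ (s i) y)) ⟩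
      ⟨ x , ρ (u ∙ s i) ⋆ y ⟩                                ∎
      where open ≡-Reasoning

module InvertibleLattices {n : ℕ} {G : FinAbGroup2 n} (L : GLattice G) where
  import Data.Nat as ℕ
  import Data.Nat.Properties as ℕ
  import Data.Nat.Divisibility as ℕ
  open import Data.Integer as ℤ using (ℤ; +_; -_; _+_; _-_; _*_; 0ℤ; 1ℤ)
  import Data.Integer.Properties as ℤ
  open import Data.Integer.Divisibility.Signed
    using (_∣_; divides; ∣-refl; ∣m∣n⇒∣m+n; ∣m⇒∣m*n; *-cancelˡ-∣; ∣⇒∣ᵤ)
  open import Data.Integer.Tactic.RingSolver using (solve-∀)
  import Data.Fin as Fin
  open import Data.Empty using (⊥; ⊥-elim)
  open import Data.Product using (∃₂; _×_; _,_; proj₁; proj₂)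
  open import Data.Sum using (inj₁; inj₂)
  open import Algebra.Bundles using (AbelianGroup)
  import Algebra.Properties.Group as GroupProperties
  import Algebra.Properties.CommutativeSemigroup as CommutativeSemigroupProperties
  open import Function using (_∘_)
  open import Function.Bundles using (_⇔_; mk⇔)
  open import Function.Properties.Equivalence using () renaming (trans to ⇔-trans; sym to ⇔-sym)
  open import Relation.Nullary using (¬_; yes; no; contradiction)
  open import Relation.Binary.PropositionalEquality
  open FiniteSums
  open Divisibility using (∣-flip)
  open LinearCombinations
  open FinAbGroup2Properties G
  open GLatticeProperties L

  open FinAbGroup2 G
  open GLattice L
  open AbelianGroup abelianGroup using (isGroup; group; commutativeSemigroup)
  open GroupProperties group using (\\-leftDividesˡ; \\-leftDividesʳ)
  open CommutativeSemigroupProperties commutativeSemigroup using (x∙yz≈y∙xz)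
  open FinGroups isGroup using (∑-translate)

  module OrbitCoordinates (m : ℕ) .{{_ : ℕ.NonZero m}} (e₀ : Vec n)
    (generates : ∀ x → ∃₂ λ (c : 𝔾 → ℤ) (y : Vec n) → x ≗ lincomb c (λ σ → ρ σ ⋆ e₀) +ᵥ + m ·ᵥ y) where

    W : 𝔾 → Vec n
    W σ = ρ σ ⋆ e₀

    V : Fin n → Vec n
    V i = W (rep i)

    lincomb-by-reps : ∀ c → lincomb c W ≗ lincomb (antisym c ∘ rep) V
    lincomb-by-reps c j = trans (∑-by-reps (λ σ → c σ * W σ j)) (∑-cong (λ i →
      trans (cong (λ w → c (rep i) * V i j + c (u ∙ rep i) * w) (ρ-u∙ (rep i) e₀ j))
            (factor (c (rep i)) (c (u ∙ rep i)) (V i j))))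
      where
      factor : ∀ a b v → a * v + b * - v ≡ (a - b) * v
      factor = solve-∀

    V-spans : ∀ x → ∃₂ λ (d : Fin n → ℤ) (y : Vec n) → x ≗ lincomb d V +ᵥ + m ·ᵥ y
    V-spans x with generates x
    ... | c , y , x≗ = antisym c ∘ rep , y , λ j → trans (x≗ j) (cong (_+ + m * y j) (lincomb-by-reps c j))

    coordinates-unique : ∀ c c′ z → lincomb c W ≗ lincomb c′ W +ᵥ + m ·ᵥ z →
                         ∀ σ → + m ∣ antisym c σ - antisym c′ σ
    coordinates-unique c c′ z c≗c′+mz =
      ∣-antisym-from-reps (+ m) c c′ (spanning⇒independent-mod m V V-spans d m∣dV)
      where
      d : Fin n → ℤ
      d i = antisym c (rep i) - antisym c′ (rep i)

      cancel : ∀ a m z → a + m * z - a ≡ z * m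
      cancel = solve-∀

      m∣dV : ∀ j → + m ∣ lincomb d V j
      m∣dV j = divides (z j) (begin
        lincomb d V j
          ≡⟨ lincomb-distrib-minus (antisym c ∘ rep) (antisym c′ ∘ rep) V j ⟩
        lincomb (antisym c ∘ rep) V j - lincomb (antisym c′ ∘ rep) V j
          ≡⟨ sym (cong₂ _-_ (lincomb-by-reps c j) (lincomb-by-reps c′ j)) ⟩
        lincomb c W j - lincomb c′ W j
          ≡⟨ cong (_- lincomb c′ W j) (c≗c′+mz j) ⟩
        lincomb c′ W j + + m * z j - lincomb c′ W j
          ≡⟨ cancel (lincomb c′ W j) (+ m) (z j) ⟩
        z j * + m
          ∎)
        where open ≡-Reasoning

    lincomb-translate : ∀ c g → lincomb c (λ σ → ρ g ⋆ W σ) ≗ lincomb (λ σ → c ((g ⁻¹) ∙ σ)) W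
    lincomb-translate c g j = begin
      ∑ (λ σ → c σ * (ρ g ⋆ W σ) j)
        ≡⟨ ∑-cong (λ σ → cong (c σ *_) (sym (act-∙ g σ e₀ j))) ⟩
      ∑ (λ σ → c σ * W (g ∙ σ) j)
        ≡⟨ ∑-translate (g ⁻¹) (λ σ → c σ * W (g ∙ σ) j) ⟩
      ∑ (λ σ → c ((g ⁻¹) ∙ σ) * W (g ∙ ((g ⁻¹) ∙ σ)) j)
        ≡⟨ ∑-cong (λ σ → cong (λ τ → c ((g ⁻¹) ∙ σ) * W τ j) (\\-leftDividesˡ g σ)) ⟩
      ∑ (λ σ → c ((g ⁻¹) ∙ σ) * W σ j)
        ∎
      where open ≡-Reasoning

  module Stabiliser (invertible : Invertible) (e : Vec n) (short-e : short e)
                    (τ : 𝔾) (τ∉⟨u⟩ : ¬ τ ∈⟨u⟩) (τe≗e : ρ τ ⋆ e ≗ e) where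

    open OrderModulo⟨u⟩ τ τ∉⟨u⟩ using (R; 1<R; 2R∣∑)

    e₀ : Vec n
    e₀ = proj₁ (proj₂ invertible R (ℕ.s≤s ℕ.z≤n))

    generates : ∀ x → ∃₂ λ (c : 𝔾 → ℤ) (y : Vec n) → x ≗ lincomb c (λ σ → ρ σ ⋆ e₀) +ᵥ + R ·ᵥ y
    generates = proj₂ (proj₂ invertible R (ℕ.s≤s ℕ.z≤n))

    open OrbitCoordinates R e₀ generates

    a : 𝔾 → ℤ
    a = proj₁ (generates e)

    y : Vec n
    y = proj₁ (proj₂ (generates e))

    e≗ : e ≗ lincomb a W +ᵥ + R ·ᵥ y
    e≗ = proj₂ (proj₂ (generates e))

    a-τ : 𝔾 → ℤ
    a-τ σ = a ((τ ⁻¹) ∙ σ)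

    e≗τ-translate : e ≗ lincomb a-τ W +ᵥ + R ·ᵥ (ρ τ ⋆ y)
    e≗τ-translate j = begin
      e j                                                  ≡⟨ sym (τe≗e j) ⟩
      (ρ τ ⋆ e) j                                          ≡⟨ ⋆-cong (ρ τ) e≗ j ⟩
      (ρ τ ⋆ (lincomb a W +ᵥ + R ·ᵥ y)) j                 ≡⟨ ⋆-lincomb+scale (ρ τ) a W (+ R) y j ⟩
      lincomb a (λ σ → ρ τ ⋆ W σ) j + + R * (ρ τ ⋆ y) j    ≡⟨ cong (_+ + R * (ρ τ ⋆ y) j)
                                                                   (lincomb-translate a τ j) ⟩
      lincomb a-τ W j + + R * (ρ τ ⋆ y) j                  ∎
      where open ≡-Reasoning

    R∣antisym-a-τ∙ : ∀ σ → + R ∣ antisym a (τ ∙ σ) - antisym a σ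
    R∣antisym-a-τ∙ σ = ∣-flip (antisym a σ) (antisym a (τ ∙ σ))
      (subst (λ x → + R ∣ x - antisym a (τ ∙ σ)) antisym-a-τ≡
             (coordinates-unique a-τ a (y -ᵥ ρ τ ⋆ y) a-τ≗ (τ ∙ σ)))
      where
      rearrange : ∀ A′ A m z z′ → A′ + m * z′ ≡ A + m * z → A′ ≡ A + m * (z - z′)
      rearrange A′ A m z z′ eq = trans (step₁ A′ m z′) (trans (cong (_- m * z′) eq) (step₂ A m z z′))
        where
        step₁ : ∀ A′ m z′ → A′ ≡ A′ + m * z′ - m * z′
        step₁ = solve-∀
        step₂ : ∀ A m z z′ → A + m * z - m * z′ ≡ A + m * (z - z′)
        step₂ = solve-∀
      a-τ≗ : lincomb a-τ W ≗ lincomb a W +ᵥ + R ·ᵥ (y -ᵥ ρ τ ⋆ y)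
      a-τ≗ j = rearrange (lincomb a-τ W j) (lincomb a W j) (+ R) (y j) ((ρ τ ⋆ y) j)
                         (trans (sym (e≗τ-translate j)) (e≗ j))
      antisym-a-τ≡ : antisym a-τ (τ ∙ σ) ≡ antisym a σ
      antisym-a-τ≡ = cong₂ (λ x x′ → a x - a x′) (\\-leftDividesʳ τ σ)
        (trans (x∙yz≈y∙xz (τ ⁻¹) u (τ ∙ σ)) (cong (u ∙_) (\\-leftDividesʳ τ σ)))

    f : 𝔾 → ℤ
    f σ = ⟨ e , W σ ⟩

    f-u∙ : ∀ σ → f (u ∙ σ) ≡ - f σ
    f-u∙ σ = trans (⟨⟩-congʳ e (ρ-u∙ σ e₀)) (⟨⟩-negʳ e (W σ))

    f-τ∙ : ∀ σ → f (τ ∙ σ) ≡ f σ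
    f-τ∙ σ = trans (⟨⟩-cong {e} {ρ τ ⋆ e} (sym ∘ τe≗e) (act-∙ τ σ e₀)) (act-form τ e (W σ))

    k : 𝔾 → ℤ
    k σ = antisym a σ * f σ

    k-u∙ : ∀ σ → k (u ∙ σ) ≡ k σ
    k-u∙ σ = trans (cong₂ _*_ (antisym-u∙ a σ) (f-u∙ σ)) (neg*neg (antisym a σ) (f σ))
      where
      neg*neg : ∀ x y → - x * - y ≡ x * y
      neg*neg = solve-∀

    R∣k-τ∙ : ∀ σ → + R ∣ k (τ ∙ σ) - k σ
    R∣k-τ∙ σ = subst (+ R ∣_) (trans (factor (antisym a (τ ∙ σ)) (antisym a σ) (f σ))
                                      (cong (λ x → antisym a (τ ∙ σ) * x - k σ) (sym (f-τ∙ σ))))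
                     (∣m⇒∣m*n (f σ) (R∣antisym-a-τ∙ σ))
      where
      factor : ∀ x x′ y → (x - x′) * y ≡ x * y - x′ * y
      factor = solve-∀

    S : ℤ
    S = ∑ (λ σ → a σ * f σ)

    ∑k≡2S : ∑ k ≡ + 2 * S
    ∑k≡2S = begin
      ∑ k
        ≡⟨ ∑-cong (λ σ → distrib (a σ) (a (u ∙ σ)) (f σ)) ⟩
      ∑ (λ σ → a σ * f σ - a (u ∙ σ) * f σ)
        ≡⟨ ∑-distrib-minus (λ σ → a σ * f σ) (λ σ → a (u ∙ σ) * f σ) ⟩
      S - ∑ (λ σ → a (u ∙ σ) * f σ)
        ≡⟨ cong (_-_ S) (∑-translate u (λ σ → a (u ∙ σ) * f σ)) ⟩
      S - ∑ (λ σ → a (u ∙ (u ∙ σ)) * f (u ∙ σ))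
        ≡⟨ cong (_-_ S) (∑-cong (λ σ → cong₂ _*_ (cong a (u∙u∙ σ)) (f-u∙ σ))) ⟩
      S - ∑ (λ σ → a σ * - f σ)
        ≡⟨ cong (_-_ S) (∑-cong (λ σ → sym (ℤ.neg-distribʳ-* (a σ) (f σ)))) ⟩
      S - ∑ (λ σ → - (a σ * f σ))
        ≡⟨ cong (_-_ S) (∑-neg (λ σ → a σ * f σ)) ⟩
      S - - S
        ≡⟨ double S ⟩
      + 2 * S
        ∎
      where
      open ≡-Reasoning
      distrib : ∀ x x′ y → (x - x′) * y ≡ x * y - x′ * y
      distrib = solve-∀
      double : ∀ S → S - - S ≡ + 2 * S
      double = solve-∀

    ⟨e,e⟩≡ : ⟨ e , e ⟩ ≡ S + + R * ⟨ e , y ⟩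
    ⟨e,e⟩≡ = begin
      ⟨ e , e ⟩                                   ≡⟨ ⟨⟩-congʳ e e≗ ⟩
      ⟨ e , lincomb a W +ᵥ + R ·ᵥ y ⟩            ≡⟨ ⟨⟩-+ʳ e (lincomb a W) (+ R ·ᵥ y) ⟩
      ⟨ e , lincomb a W ⟩ + ⟨ e , + R ·ᵥ y ⟩     ≡⟨ cong₂ _+_ (⟨⟩-lincombʳ e a W) (⟨⟩-scaleʳ e (+ R) y) ⟩
      S + + R * ⟨ e , y ⟩                         ∎
      where open ≡-Reasoning

    R∣1 : + R ∣ 1ℤ
    R∣1 = subst (+ R ∣_) (trans (sym ⟨e,e⟩≡) short-e) (∣m∣n⇒∣m+n R∣S (∣m⇒∣m*n ⟨ e , y ⟩ ∣-refl))
      where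
      R∣S : + R ∣ S
      R∣S = *-cancelˡ-∣ (+ 2) (subst (+ 2 * + R ∣_) ∑k≡2S (2R∣∑ k k-u∙ R∣k-τ∙))

    absurd : ⊥
    absurd = ℕ.<⇒≱ 1<R (ℕ.∣⇒≤ (∣⇒∣ᵤ R∣1))

  stabiliser⊆⟨u⟩ : Invertible → ∀ e → short e → ∀ τ → ρ τ ⋆ e ≗ e → τ ∈⟨u⟩
  stabiliser⊆⟨u⟩ invertible e short-e τ τe≗e with τ ∈⟨u⟩?
  ... | yes τ∈⟨u⟩ = τ∈⟨u⟩
  ... | no  τ∉⟨u⟩ = ⊥-elim (Stabiliser.absurd invertible e short-e τ τ∉⟨u⟩ τe≗e)

  stabiliser-trivial : Invertible → ∀ e → short e → ∀ σ → ρ σ ⋆ e ≗ e ⇔ σ ≡ ε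
  stabiliser-trivial invertible e short-e σ = mk⇔ fixes⇒ε (λ { refl → act-ε e })
    where
    fixes⇒ε : ρ σ ⋆ e ≗ e → σ ≡ ε
    fixes⇒ε σe≗e with stabiliser⊆⟨u⟩ invertible e short-e σ σe≗e
    ... | inj₁ σ≡ε  = σ≡ε
    ... | inj₂ refl = contradiction σe≗e (u-moves-short e short-e)

  short-inner-products : Invertible → ∀ e → short e → ∀ σ →
    (σ ≡ ε → ⟨ e , ρ σ ⋆ e ⟩ ≡ 1ℤ) × (σ ≡ u → ⟨ e , ρ σ ⋆ e ⟩ ≡ - 1ℤ) ×
    (σ ≢ ε → σ ≢ u → ⟨ e , ρ σ ⋆ e ⟩ ≡ 0ℤ)
  short-inner-products invertible e short-e σ = at-ε , at-u , elsewhere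
    where
    at-ε : σ ≡ ε → ⟨ e , ρ σ ⋆ e ⟩ ≡ 1ℤ
    at-ε refl = trans (⟨⟩-congʳ e (act-ε e)) short-e
    at-u : σ ≡ u → ⟨ e , ρ σ ⋆ e ⟩ ≡ - 1ℤ
    at-u refl = trans (⟨⟩-congʳ e (act-u e)) (trans (⟨⟩-negʳ e e) (cong -_ short-e))
    elsewhere : σ ≢ ε → σ ≢ u → ⟨ e , ρ σ ⋆ e ⟩ ≡ 0ℤ
    elsewhere σ≢ε σ≢u with unit-vectors e (ρ σ ⋆ e) short-e (trans (act-form σ e e) short-e)
    ... | inj₁ ⟨e,σe⟩≡0    = ⟨e,σe⟩≡0
    ... | inj₂ (inj₁ σe≗e)  = contradiction (stabiliser⊆⟨u⟩ invertible e short-e σ σe≗e) (∉⟨u⟩ σ≢ε σ≢u)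
    ... | inj₂ (inj₂ σe≗-e) = contradiction (∈⟨u⟩-u∙ (stabiliser⊆⟨u⟩ invertible e short-e (u ∙ σ) uσe≗e))
                                            (∉⟨u⟩ σ≢ε σ≢u)
      where
      uσe≗e : ρ (u ∙ σ) ⋆ e ≗ e
      uσe≗e i = trans (ρ-u∙ σ e i) (trans (cong -_ (σe≗-e i)) (ℤ.neg-involutive (e i)))

  short⇔inner-products : Invertible → ∀ e → short e ⇔ (∀ τ → ⟨ e , ρ τ ⋆ e ⟩ ≡ δ ε τ - δ u τ)
  short⇔inner-products invertible e = mk⇔ inner-products short-at-ε
    where
    inner-products : short e → ∀ τ → ⟨ e , ρ τ ⋆ e ⟩ ≡ δ ε τ - δ u τ
    inner-products short-e τ with short-inner-products invertible e short-e τ | τ Fin.≟ ε | τ Fin.≟ u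
    ... | at-ε , _ , _      | yes refl | no _     = at-ε refl
    ... | _ , _ , _         | yes refl | yes ε≡u  = contradiction (sym ε≡u) u≢ε
    ... | _ , at-u , _      | no _     | yes refl = at-u refl
    ... | _ , _ , elsewhere | no τ≢ε   | no τ≢u   = elsewhere τ≢ε τ≢u

    short-at-ε : (∀ τ → ⟨ e , ρ τ ⋆ e ⟩ ≡ δ ε τ - δ u τ) → short e
    short-at-ε inner-products = begin
      ⟨ e , e ⟩            ≡⟨ ⟨⟩-congʳ e (sym ∘ act-ε e) ⟩
      ⟨ e , ρ ε ⋆ e ⟩      ≡⟨ inner-products ε ⟩
      δ ε ε - δ u ε        ≡⟨ cong₂ _-_ (δ-same ε) (δ-diff (u≢ε ∘ sym)) ⟩
      1ℤ                   ∎
      where open ≡-Reasoning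

  short⇔lifted≈δε : Invertible → ∀ s → IsCosetReps s → ∀ e → short e ⇔ (lifted s e e ≈⟨G⟩ δ ε)
  short⇔lifted≈δε invertible s s-reps e =
    ⇔-trans (short⇔inner-products invertible e)
            (⇔-trans inner-products⇔antisym (⇔-sym (≈⟨G⟩⇔antisym-≗ (lifted s e e) (δ ε))))
    where
    open Lifted s s-reps e e using (lifted-antisym)
    inner-products⇔antisym :
      (∀ τ → ⟨ e , ρ τ ⋆ e ⟩ ≡ δ ε τ - δ u τ) ⇔ (antisym (lifted s e e) ≗ antisym (δ ε))
    inner-products⇔antisym = mk⇔
      (λ inner-products τ → trans (lifted-antisym τ) (trans (inner-products τ) (sym (antisym-δε τ))))
      (λ antisym≗ τ → trans (sym (lifted-antisym τ)) (trans (antisym≗ τ) (antisym-δε τ)))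

open import Data.Nat using (ℕ; _*_)
open import Data.Integer using (+_; -_)
open import Data.Fin using (Fin)
open import Data.Product using (_×_; _,_)
open import Function.Bundles using (_⇔_)
open import Relation.Binary.PropositionalEquality using (_≡_; _≢_)

proposition12p3 : ∀ {n : ℕ} (G : FinAbGroup2 n) (L : GLattice G) →
  let open FinAbGroup2 G
      open GLattice L
  in
  Invertible →
  (∀ (e : Vec n) → short e → ∀ σ → (∀ i → (ρ σ ⋆ e) i ≡ e i) ⇔ (σ ≡ ε)) ×
  (∀ (e : Vec n) → short e → ∀ σ →
     (σ ≡ ε → ⟨ e , ρ σ ⋆ e ⟩ ≡ + 1) ×
     (σ ≡ u → ⟨ e , ρ σ ⋆ e ⟩ ≡ - (+ 1)) ×
     (σ ≢ ε → σ ≢ u → ⟨ e , ρ σ ⋆ e ⟩ ≡ + 0)) ×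
  (∀ (s : Fin n → Fin (2 * n)) → IsCosetReps s → ∀ (e : Vec n) →
     short e ⇔ (lifted s e e ≈⟨G⟩ δ ε))
proposition12p3 G L invertible =
  stabiliser-trivial invertible , short-inner-products invertible , short⇔lifted≈δε invertible
  where open InvertibleLattices L
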